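{- Let $\boldsymbol\lambda=(\lambda_1,\ldots,\lambda_a)$, $\boldsymbol\mu=(\mu_1,\ldots,\mu_b)$, $\boldsymbol\nu=(\nu_1,\ldots,\nu_c)$ be sequences of positive integers with $a,b\ge1$ and $c\ge0$. Then in $\mathcal{B}$ \begin{align*} \mathrm{li}(\boldsymbol\lambda,\boldsymbol\mu,\boldsymbol\nu;T) =&\sum_{\tau=0}^{\mu_b-1}\binom{\lambda_a-1+\tau}{\tau}\mathrm{li}\big((\lambda_1,\ldots,\lambda_{a-1}),(\mu_1,\ldots,\mu_{b-1},\mu_b-\tau),(\lambda_a+\tau,\nu_1,\ldots,\nu_c);T\big)\\ &+\sum_{\tau=0}^{\lambda_a-1}\binom{\mu_b-1+\tau}{\tau}\mathrm{li}\big((\lambda_1,\ldots,\lambda_{a-1},\lambda_a-\tau),(\mu_1,\ldots,\mu_{b-1}),(\mu_b+\tau,\nu_1,\ldots,\nu_c);T\big)\\ &+(-1)^{\mu_1+\cdots+\mu_b}\Big(\sum_{i=1}^{a+b-1}\zeta^{(i)}_{\mathcal{A}}(\boldsymbol\lambda\star\boldsymbol\mu)(T^p)^i\Big)\mathrm{li}_{\boldsymbol\nu}(T)\\ &-\binom{\lambda_a+\mu_b-1}{\lambda_a}\Big(\sum_{j=1}^{a-1}\zeta^{(j)}_{\mathcal{A}}(\lambda_1,\ldots,\lambda_{a-1})(T^p)^j\Big)\mathrm{li}_{\mu_1,\ldots,\mu_{b-1},\lambda_a+\mu_b,\nu_1,\ldots,\nu_c}(T)\\ &-\binom{\lambda_a+\mu_b-1}{\mu_b}\Big(\sum_{j=1}^{b-1}\zeta^{(j)}_{\mathcal{A}}(\mu_1,\ldots,\mu_{b-1})(T^p)^j\Big)\mathrm{li}_{\lambda_1,\ldots,\lambda_{a-1},\lambda_a+\mu_b,\nu_1,\ldots,\nu_c}(T),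 \end{align*} where $\boldsymbol\lambda\star\boldsymbol\mu:=(\lambda_1,\ldots,\lambda_{a-1},\lambda_a+\mu_b,\mu_{b-1},\ldots,\mu_1)$ and empty sums are $0$.
   Context: $\mathcal{B}:=\big(\prod_{p\text{ prime}}\mathbb{F}_p[T]\big)/\big(\bigoplus_{p}\mathbb{F}_p[T]\big)$ and $\mathcal{A}:=\big(\prod_{p}\mathbb{F}_p\big)/\big(\bigoplus_{p}\mathbb{F}_p\big)$; an element is represented by a family $(f_p)_p$, two families being equal iff they agree for all but finitely many primes $p$; $\mathcal{A}\subset\mathcal{B}$ via constants, and $T^p$ is the element with $p$-component $T^p$. A primed sum $\sum'$ denotes the sum over only those tuples for which every factor occurring in the denominator is prime to $p$, each term being read in $\mathbb{F}_p[T]$. For sequences of positive integers $\boldsymbol\lambda=(\lambda_1,\ldots,\lambda_a)$, $\boldsymbol\mu=(\mu_1,\ldots,\mu_b)$, $\boldsymbol\nu=(\nu_1,\ldots,\nu_c)$ ($a,b,c\ge0$, empty sequences allowed), with $L_x=l_1+\cdots+l_x$, $M_y=m_1+\cdots+m_y$, $N_z=n_1+\cdots+n_z$ (and $L_0=M_0=N_0=0$), $$\mathrm{li}(\boldsymbol\lambda,\boldsymbol\mu,\boldsymbol\nu;T):=\Big({\sum_{\substack{0<l_1,\ldots,l_a<p\\0<m_1,\ldots,m_b<p\\0<n_1,\ldots,n_c<p}}}'\frac{T^{L_a+M_b+N_c}}{\prod_{x=1}^aL_x^{\lambda_x}\prod_{y=1}^bM_y^{\mu_y}\prod_{z=1}^c(L_a+M_b+N_z)^{\nu_z}}\Big)_p\in\mathcal{B}.$$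 For a sequence $\mathbf{k}=(k_1,\ldots,k_r)$ of positive integers, $\mathrm{li}_{\mathbf{k}}(T):=\mathrm{li}(\emptyset,\emptyset,\mathbf{k};T)=\big(\sum'_{0<l_1,\ldots,l_r<p}T^{L_r}/(L_1^{k_1}\cdots L_r^{k_r})\big)_p$ (equal to $1$ if $r=0$), and for $1\le i\le r$ $$\zeta^{(i)}_{\mathcal{A}}(\mathbf{k}):=\Big({\sum_{\substack{0<l_1,\ldots,l_r<p\\(i-1)p<L_r<ip}}}'\frac{1}{L_1^{k_1}\cdots L_r^{k_r}}\Big)_p\in\mathcal{A}.$$ -}

module Defs where

open import Data.Nat as ℕ using (ℕ; zero; suc; _+_; _*_; _∸_; _^_; _<_; _<?_)
open import Data.Nat.Divisibility using (_∣?_)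
open import Data.Nat.Primality using (Prime)
open import Data.Integer as ℤ using (ℤ; +_)
open import Data.Integer.Divisibility as ℤD using ()
open import Data.List using (List; []; _∷_; [_]; _++_; map; concatMap; upTo; length; zipWith; foldr; filter)
open import Data.Product using (_×_; _,_; ∃-syntax)
open import Data.Bool using (Bool; true; false; not; _∧_; if_then_else_)
open import Relation.Nullary using (does)
open import Data.Nat.ListAction using (sum; product)

-- Elements of F_p are represented by fractions a/d (a ∈ ℤ, d ∈ ℕ) with
-- d prime to p (image of the localisation Z_(p) → F_p).  All fractions
-- built below have denominators that are products of integers prime to p.

Frac : Set
Frac = ℤ × ℕ

0f 1f : Frac
0f = (+ 0 , 1)
1f = (+ 1 , 1)

ι : ℤ → Frac
ι n = (n , 1)

_+f_ : Frac → Frac → Frac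
(a , b) +f (c , d) = (a ℤ.* + d ℤ.+ c ℤ.* + b , b * d)

_*f_ : Frac → Frac → Frac
(a , b) *f (c , d) = (a ℤ.* c , b * d)

inv : ℕ → Frac
inv d = (+ 1 , d)

_≡[_]_ : Frac → ℕ → Frac → Set
(a , b) ≡[ p ] (c , d) = (+ p) ℤD.∣ (a ℤ.* + d ℤ.- c ℤ.* + b)

sumF : List Frac → Frac
sumF = foldr _+f_ 0f

sgn : ℕ → ℤ
sgn zero = + 1
sgn (suc n) = ℤ.- sgn n

-- Polynomials in F_p[T] as formal finite sums of monomials c·T^e.

Poly : Set
Poly = List (ℕ × Frac)

coeff : ℕ → Poly → Frac
coeff n [] = 0f
coeff n ((e , c) ∷ P) = if does (e ℕ.≟ n) then c +f coeff n P else coeff n P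

const : Frac → Poly
const c = [ (0 , c) ]

monomial : ℕ → Poly
monomial e = [ (e , 1f) ]

_⊕_ : Poly → Poly → Poly
_⊕_ = _++_

scale : Frac → Poly → Poly
scale c = map (λ { (e , d) → (e , c *f d) })

_⊛_ : Poly → Poly → Poly
P ⊛ Q = concatMap (λ { (e , c) → map (λ { (e' , d) → (e + e' , c *f d) }) Q }) P

⊖_ : Poly → Poly
⊖ P = scale (ι (ℤ.- (+ 1))) P

sumP : List Poly → Poly
sumP = foldr _⊕_ []

infixl 6 _⊕_
infixl 7 _⊛_

-- The ring B: families indexed by p, equal iff they agree for all but
-- finitely many primes p (as polynomials over F_p, coefficientwise).

_≈B_ : (ℕ → Poly) → (ℕ → Poly) → Set
P ≈B Q = ∃[ N ] ((p : ℕ) → Prime p → N < p →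
           (n : ℕ) → coeff n (P p) ≡[ p ] coeff n (Q p))

infix 4 _≈B_

range : ℕ → List ℕ
range p = map suc (upTo (p ∸ 1))

oneTo : ℕ → List ℕ
oneTo n = map suc (upTo n)

tuples : ℕ → ℕ → List (List ℕ)
tuples p zero = [ [] ]
tuples p (suc r) = concatMap (λ l → map (l ∷_) (tuples p r)) (range p)

partialSums : List ℕ → List ℕ
partialSums = go 0
  where
  go : ℕ → List ℕ → List ℕ
  go acc [] = []
  go acc (x ∷ xs) = (acc + x) ∷ go (acc + x) xs

primeToAll : ℕ → List ℕ → Bool
primeToAll p = foldr (λ L b → not (does (p ∣? L)) ∧ b) true

denom : List ℕ → List ℕ → ℕ
denom factors exps = product (zipWith _^_ factors exps)

li : List ℕ → List ℕ → List ℕ → ℕ → Poly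
li lam mu nu p =
  concatMap (λ l → concatMap (λ m → concatMap (λ n → term l m n)
    (tuples p (length nu))) (tuples p (length mu))) (tuples p (length lam))
  where
  term : List ℕ → List ℕ → List ℕ → Poly
  term l m n =
    let La = sum l
        Mb = sum m
        factors = partialSums l ++ partialSums m ++ map (λ N → La + Mb + N) (partialSums n)
    in if primeToAll p factors
       then [ (La + Mb + sum n , inv (denom factors (lam ++ mu ++ nu))) ]
       else []

liₖ : List ℕ → ℕ → Poly
liₖ k = li [] [] k

ζA : ℕ → List ℕ → ℕ → Frac
ζA i k p = sumF (concatMap term (tuples p (length k)))
  where
  term : List ℕ → List Frac
  term l =
    let factors = partialSums l
        Lr = sum l
    in if primeToAll p factors ∧ does ((i ∸ 1) * p <? Lr) ∧ does (Lr <? i * p)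
       then [ inv (denom factors k) ]
       else []

ζsum : ℕ → List ℕ → ℕ → Poly
ζsum n k p = map (λ i → (p * i , ζA i k p)) (oneTo n)

binom : ℕ → ℕ → Frac
binom n k = ι (+ (n C k))
  where open import Data.Nat.Combinatorics using (_C_)

module Submission where

-- The identity is proved coefficientwise at every prime p, so the
-- bound N is 0.  Fix p; a fraction a/d is read in ℤ/p as a·d⁻¹ (d⁻¹ a Bézout
-- inverse, taken to be 0 when p ∣ d) and a polynomial as its coefficient function.
-- Then li(λ,μ,ν) is a sum over tuples of weights W, products of inverse powers of
-- partial sums; excluded terms vanish by themselves since 0⁻¹ = 0.  Splitting off
-- the last entries x of l and y of m, both sides become sums of one common factor
-- times a function of X = L_a and Y = M_b, and the heart of the proof is a
-- pointwise identity: the partial fraction decomposition of X^(-λ_a) Y^(-μ_b), with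
-- correction terms when p divides X, Y or X + Y.  These are resummed by the
-- distribution lemma (among A+1, …, A+p-1 only (q+1)p is a multiple of p, giving
-- the ζ^(j)-coefficient of T^(jp)) and, for p ∣ X + Y, the reversal lemma
-- (M_y ≡ -(L_a + M_b - M_y) mod p).

open import Defs
open import Data.Nat as ℕ using (ℕ; zero; suc; _∸_; _<_; _≤_; z≤n; s≤s)
import Data.Nat.Properties as ℕP
import Data.Nat.Divisibility as ℕD
open import Data.Nat.Primality using (Prime; euclidsLemma; prime⇒irreducible; prime⇒nonTrivial; ¬prime[1])
open import Data.Nat.Coprimality using (Coprime; coprime?; coprime-Bézout)
open import Data.Nat.GCD using (module Bézout)
open import Data.Nat.Combinatorics using (_C_; nCk+nC[k+1]≡[n+1]C[k+1]; nCn≡1; nCk≡nC[n∸k])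
open import Data.Nat.DivMod using (_/_; _%_; m≡m%n+[m/n]*n; m%n<n)
open import Data.Nat.ListAction using (sum)
open import Data.Nat.ListAction.Properties using (sum-++; sum-↭)
import Data.Nat.Tactic.RingSolver as ℕSolver
open import Data.Integer as Int using (ℤ; +_)
import Data.Integer.Properties as ℤP
import Data.Integer.Divisibility.Signed as ℤD
open import Data.Integer.Tactic.RingSolver using (solve-∀)
open import Data.List using (List; []; _∷_; [_]; _++_; map; concatMap; upTo; applyUpTo; length; reverse; _∷ʳ_)
import Data.List.Properties as LP
open import Data.List.Relation.Binary.Permutation.Propositional using (↭-sym)
open import Data.List.Relation.Binary.Permutation.Propositional.Properties using (↭-reverse; All-resp-↭)
open import Data.List.Membership.Propositional using (_∈_)
open import Data.List.Membership.Propositional.Properties using (∈-map⁻; ∈-upTo⁻)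
open import Data.List.Relation.Unary.Any using (here; there)
open import Data.List.Relation.Unary.All using (All; []; _∷_; universal)
import Data.List.Relation.Unary.All.Properties as AllP
open import Data.Product using (_×_; _,_; proj₁; proj₂)
open import Data.Sum using (inj₁; inj₂)
open import Data.Bool using (Bool; true; false; _∧_; if_then_else_)
open import Data.Empty using (⊥-elim)
open import Relation.Nullary using (¬_; yes; no; Dec; does)
open import Relation.Nullary.Decidable using (dec-true)
open import Relation.Binary.PropositionalEquality hiding ([_])
open import Relation.Binary.Bundles using (Setoid)
open import Function using (_∘_)

module PartialSums where
  open import Data.Nat using (_+_)

  -- Partial sums with an offset: PS s (x₁ ∷ x₂ ∷ …) = s + x₁ ∷ s + x₁ + x₂ ∷ …
  -- This is the form of the denominators L_x, M_y, L_a + M_b + N_z.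
  PS : ℕ → List ℕ → List ℕ
  PS s [] = []
  PS s (x ∷ t) = (s + x) ∷ PS (s + x) t

  partialSums≡PS : ∀ xs → partialSums xs ≡ PS 0 xs
  partialSums≡PS [] = refl
  partialSums≡PS (x ∷ xs) = cong (x ∷_) (tail≡PS x xs)
    where
    tail≡PS : ∀ a xs → Data.List.drop 1 (partialSums (a ∷ xs)) ≡ PS a xs
    tail≡PS a [] = refl
    tail≡PS a (x ∷ xs) = cong ((a + x) ∷_) (tail≡PS (a + x) xs)

  map-PS : ∀ s a t → map (λ N → s + N) (PS a t) ≡ PS (s + a) t
  map-PS s a [] = refl
  map-PS s a (x ∷ t) = cong₂ _∷_ (sym (ℕP.+-assoc s a x))
    (trans (map-PS s (a + x) t) (cong (λ z → PS z t) (sym (ℕP.+-assoc s a x))))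

  length-PS : ∀ s t → length (PS s t) ≡ length t
  length-PS s [] = refl
  length-PS s (x ∷ t) = cong suc (length-PS (s + x) t)

  PS-++ : ∀ s t u → PS s (t ++ u) ≡ PS s t ++ PS (s + sum t) u
  PS-++ s [] u = cong (λ z → PS z u) (sym (ℕP.+-identityʳ s))
  PS-++ s (x ∷ t) u = cong ((s + x) ∷_) (trans (PS-++ (s + x) t u)
    (cong (λ z → PS (s + x) t ++ PS z u) (ℕP.+-assoc s x (sum t))))

  length-partialSums : ∀ t → length (partialSums t) ≡ length t
  length-partialSums t = trans (cong length (partialSums≡PS t)) (length-PS 0 t)

  sum-∷ʳ : ∀ t x → sum (t ∷ʳ x) ≡ sum t + x
  sum-∷ʳ t x = trans (sum-++ t [ x ]) (cong (_+_ (sum t)) (ℕP.+-identityʳ x))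

  sum-reverse : ∀ xs → sum (reverse xs) ≡ sum xs
  sum-reverse xs = sum-↭ (↭-reverse xs)

  length-∷ʳ : ∀ (xs : List ℕ) z → length (xs ∷ʳ z) ≡ suc (length xs)
  length-∷ʳ xs z = trans (LP.length-++ xs) (ℕP.+-comm (length xs) 1)

open PartialSums

module Sums where
  open Int using (_+_; _*_; -_)

  Σ : ∀ {A : Set} → List A → (A → ℤ) → ℤ
  Σ [] f = + 0
  Σ (x ∷ xs) f = f x + Σ xs f

  Σ-cong≡ : ∀ {A : Set} (xs : List A) {f g : A → ℤ} → (∀ x → f x ≡ g x) → Σ xs f ≡ Σ xs g
  Σ-cong≡ [] h = refl
  Σ-cong≡ (x ∷ xs) h = cong₂ _+_ (h x) (Σ-cong≡ xs h)

  Σ-++ : ∀ {A : Set} (xs ys : List A) (f : A → ℤ) → Σ (xs ++ ys) f ≡ Σ xs f + Σ ys f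
  Σ-++ [] ys f = sym (ℤP.+-identityˡ _)
  Σ-++ (x ∷ xs) ys f = trans (cong (_+_ (f x)) (Σ-++ xs ys f)) (sym (ℤP.+-assoc (f x) _ _))

  Σ-map : ∀ {A B : Set} (g : A → B) (xs : List A) (f : B → ℤ) → Σ (map g xs) f ≡ Σ xs (f ∘ g)
  Σ-map g [] f = refl
  Σ-map g (x ∷ xs) f = cong (_+_ (f (g x))) (Σ-map g xs f)

  Σ-concatMap : ∀ {A B : Set} (g : A → List B) (xs : List A) (f : B → ℤ) →
                Σ (concatMap g xs) f ≡ Σ xs (λ x → Σ (g x) f)
  Σ-concatMap g [] f = refl
  Σ-concatMap g (x ∷ xs) f =
    trans (Σ-++ (g x) (concatMap g xs) f) (cong (_+_ (Σ (g x) f)) (Σ-concatMap g xs f))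

  Σ-+ : ∀ {A : Set} (xs : List A) (f g : A → ℤ) → Σ xs (λ x → f x + g x) ≡ Σ xs f + Σ xs g
  Σ-+ [] f g = refl
  Σ-+ (x ∷ xs) f g = trans (cong (_+_ (f x + g x)) (Σ-+ xs f g)) (interchange (f x) (g x) _ _)
    where
    interchange : ∀ a b c d → (a + b) + (c + d) ≡ (a + c) + (b + d)
    interchange = solve-∀

  Σ-* : ∀ {A : Set} (xs : List A) (c : ℤ) (f : A → ℤ) → Σ xs (λ x → c * f x) ≡ c * Σ xs f
  Σ-* [] c f = sym (ℤP.*-zeroʳ c)
  Σ-* (x ∷ xs) c f = trans (cong (_+_ (c * f x)) (Σ-* xs c f)) (sym (ℤP.*-distribˡ-+ c (f x) _))

  Σ-*ʳ : ∀ {A : Set} (xs : List A) (c : ℤ) (f : A → ℤ) → Σ xs (λ x → f x * c) ≡ Σ xs f * c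
  Σ-*ʳ [] c f = refl
  Σ-*ʳ (x ∷ xs) c f = trans (cong (_+_ (f x * c)) (Σ-*ʳ xs c f)) (sym (ℤP.*-distribʳ-+ c (f x) _))

  Σ-neg : ∀ {A : Set} (xs : List A) (f : A → ℤ) → Σ xs (λ x → - f x) ≡ - Σ xs f
  Σ-neg [] f = refl
  Σ-neg (x ∷ xs) f = trans (cong (_+_ (- f x)) (Σ-neg xs f)) (sym (ℤP.neg-distrib-+ (f x) _))

  Σ-0 : ∀ {A : Set} (xs : List A) → Σ xs (λ _ → + 0) ≡ + 0
  Σ-0 [] = refl
  Σ-0 (x ∷ xs) = trans (ℤP.+-identityˡ _) (Σ-0 xs)

  Σ-comm : ∀ {A B : Set} (xs : List A) (ys : List B) (f : A → B → ℤ) →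
           Σ xs (λ x → Σ ys (λ y → f x y)) ≡ Σ ys (λ y → Σ xs (λ x → f x y))
  Σ-comm [] ys f = sym (Σ-0 ys)
  Σ-comm (x ∷ xs) ys f = trans (cong (_+_ (Σ ys (f x))) (Σ-comm xs ys f))
                              (sym (Σ-+ ys (f x) (λ y → Σ xs (λ x → f x y))))

  Σ-upTo-suc : ∀ n (f : ℕ → ℤ) → Σ (upTo (suc n)) f ≡ Σ (upTo n) f + f n
  Σ-upTo-suc n f = trans (cong (λ l → Σ l f) (sym (LP.upTo-∷ʳ n)))
                         (trans (Σ-++ (upTo n) [ n ] f) (cong (_+_ (Σ (upTo n) f)) (ℤP.+-identityʳ (f n))))

  Σ-applyUpTo : ∀ n (g : ℕ → ℕ) (f : ℕ → ℤ) → Σ (applyUpTo g n) f ≡ Σ (upTo n) (f ∘ g)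
  Σ-applyUpTo zero g f = refl
  Σ-applyUpTo (suc n) g f =
    cong (_+_ (f (g 0))) (trans (Σ-applyUpTo n (g ∘ suc) f) (sym (Σ-applyUpTo n suc (f ∘ g))))

  Σ-upTo-cons : ∀ n (f : ℕ → ℤ) → Σ (upTo (suc n)) f ≡ f 0 + Σ (upTo n) (f ∘ suc)
  Σ-upTo-cons n f = cong (_+_ (f 0)) (Σ-applyUpTo n suc f)

open Sums

module Binomials where
  open Int using (_+_)

  pascal : ∀ a σ → + ((suc a ℕ.+ σ) C σ) + + ((a ℕ.+ suc σ) C suc σ) ≡ + ((suc a ℕ.+ suc σ) C suc σ)
  pascal a σ = begin
    + ((suc a ℕ.+ σ) C σ) + + ((a ℕ.+ suc σ) C suc σ)
      ≡⟨ cong (λ z → + ((suc a ℕ.+ σ) C σ) + + (z C suc σ)) (ℕP.+-suc a σ) ⟩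
    + ((suc a ℕ.+ σ) C σ) + + ((suc a ℕ.+ σ) C suc σ)
      ≡⟨ sym (ℤP.pos-+ ((suc a ℕ.+ σ) C σ) ((suc a ℕ.+ σ) C suc σ)) ⟩
    + ((suc a ℕ.+ σ) C σ ℕ.+ (suc a ℕ.+ σ) C suc σ)
      ≡⟨ cong +_ (nCk+nC[k+1]≡[n+1]C[k+1] (suc a ℕ.+ σ) σ) ⟩
    + (suc (suc a ℕ.+ σ) C suc σ)
      ≡⟨ cong (λ z → + (z C suc σ)) (sym (ℕP.+-suc (suc a) σ)) ⟩
    + ((suc a ℕ.+ suc σ) C suc σ) ∎
    where open ≡-Reasoning

  hockey-stick : ∀ a ρ → Σ (upTo (suc ρ)) (λ τ → + ((a ℕ.+ τ) C τ)) ≡ + ((suc a ℕ.+ ρ) C ρ)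
  hockey-stick a zero = refl
  hockey-stick a (suc ρ) = begin
    Σ (upTo (suc (suc ρ))) (λ τ → + ((a ℕ.+ τ) C τ))
      ≡⟨ Σ-upTo-suc (suc ρ) (λ τ → + ((a ℕ.+ τ) C τ)) ⟩
    Σ (upTo (suc ρ)) (λ τ → + ((a ℕ.+ τ) C τ)) + + ((a ℕ.+ suc ρ) C suc ρ)
      ≡⟨ cong (_+ + ((a ℕ.+ suc ρ) C suc ρ)) (hockey-stick a ρ) ⟩
    + ((suc a ℕ.+ ρ) C ρ) + + ((a ℕ.+ suc ρ) C suc ρ)
      ≡⟨ pascal a ρ ⟩
    + ((suc a ℕ.+ suc ρ) C suc ρ) ∎
    where open ≡-Reasoning

  -- the two ways the paper writes the coefficient C(λ_a + μ_b - 1, ·)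
  binom-symm : ∀ a b → (suc a ℕ.+ b) C b ≡ (suc a ℕ.+ suc b ∸ 1) C suc a
  binom-symm a b = sym (trans (cong (_C suc a) (ℕP.+-suc a b))
    (trans (nCk≡nC[n∸k] (s≤s (ℕP.m≤m+n a b))) (cong ((suc a ℕ.+ b) C_) (ℕP.m+n∸m≡n (suc a) b))))

open Binomials

module Signs where
  open Int using (_*_; -_; _^_)

  sgn-+ : ∀ m n → sgn (m ℕ.+ n) ≡ sgn m * sgn n
  sgn-+ zero n = sym (ℤP.*-identityˡ (sgn n))
  sgn-+ (suc m) n = trans (cong -_ (sgn-+ m n)) (ℤP.neg-distribˡ-* (sgn m) (sgn n))

  neg-^ : ∀ e a → (- a) ^ e ≡ sgn e * a ^ e
  neg-^ zero a = refl
  neg-^ (suc e) a = trans (cong ((- a) *_) (neg-^ e a)) (move-sign (sgn e) a (a ^ e))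
    where
    move-sign : ∀ s a b → (- a) * (s * b) ≡ (- s) * (a * b)
    move-sign = solve-∀

open Signs

-- With x = Y⁻¹, w = (X+Y)⁻¹ they are the coefficients of the first two
-- sums of the theorem.
module PartialFractionSums where
  open Int using (_+_; _*_; _^_)

  pfSum : ℤ → ℤ → ℕ → ℕ → ℤ
  pfSum x w a b = Σ (upTo b) (λ τ → + ((a ∸ 1 ℕ.+ τ) C τ) * (x ^ (b ∸ τ) * w ^ (a ℕ.+ τ)))

  pfSum-pascal : ∀ x w a b →
    w * (pfSum x w (suc (suc a)) (suc b) + pfSum x w (suc a) (suc (suc b))) ≡ pfSum x w (suc (suc a)) (suc (suc b))
  pfSum-pascal x w a b = begin
    w * (Σ (upTo (suc b)) g₁ + Σ (upTo (suc (suc b))) h)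
      ≡⟨ cong (λ z → w * (Σ (upTo (suc b)) g₁ + z)) (Σ-upTo-cons (suc b) h) ⟩
    w * (Σ (upTo (suc b)) g₁ + (h 0 + Σ (upTo (suc b)) (h ∘ suc)))
      ≡⟨ distribute w _ (h 0) _ ⟩
    w * h 0 + (w * Σ (upTo (suc b)) g₁ + w * Σ (upTo (suc b)) (h ∘ suc))
      ≡⟨ cong₂ _+_ (absorb w (+ 1) (x ^ suc (suc b)) (w ^ (suc a ℕ.+ 0)))
           (cong₂ _+_ (sym (Σ-* (upTo (suc b)) w g₁)) (sym (Σ-* (upTo (suc b)) w (h ∘ suc)))) ⟩
    g 0 + (Σ (upTo (suc b)) (λ σ → w * g₁ σ) + Σ (upTo (suc b)) (λ σ → w * h (suc σ)))
      ≡⟨ cong (_+_ (g 0)) (sym (Σ-+ (upTo (suc b)) (λ σ → w * g₁ σ) (λ σ → w * h (suc σ)))) ⟩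
    g 0 + Σ (upTo (suc b)) (λ σ → w * g₁ σ + w * h (suc σ))
      ≡⟨ cong (_+_ (g 0)) (Σ-cong≡ (upTo (suc b)) termwise) ⟩
    g 0 + Σ (upTo (suc b)) (g ∘ suc)
      ≡⟨ sym (Σ-upTo-cons (suc b) g) ⟩
    Σ (upTo (suc (suc b))) g ∎
    where
    open ≡-Reasoning
    g h : ℕ → ℤ
    g τ = + ((suc a ℕ.+ τ) C τ) * (x ^ (suc (suc b) ∸ τ) * w ^ (suc (suc a) ℕ.+ τ))
    h τ = + ((a ℕ.+ τ) C τ) * (x ^ (suc (suc b) ∸ τ) * w ^ (suc a ℕ.+ τ))
    g₁ : ℕ → ℤ
    g₁ σ = + ((suc a ℕ.+ σ) C σ) * (x ^ (suc b ∸ σ) * w ^ (suc (suc a) ℕ.+ σ))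
    distribute : ∀ w A h₀ B → w * (A + (h₀ + B)) ≡ w * h₀ + (w * A + w * B)
    distribute = solve-∀
    absorb : ∀ w c X W → w * (c * (X * W)) ≡ c * (X * (w * W))
    absorb = solve-∀
    collect : ∀ w c₁ c₂ X W → w * (c₁ * (X * W)) + w * (c₂ * (X * W)) ≡ (c₁ + c₂) * (X * (w * W))
    collect = solve-∀
    termwise : ∀ σ → w * g₁ σ + w * h (suc σ) ≡ g (suc σ)
    termwise σ = begin
      w * g₁ σ + w * h (suc σ)
        ≡⟨ cong (λ z → w * g₁ σ + w * (+ ((a ℕ.+ suc σ) C suc σ) * (x ^ (suc b ∸ σ) * w ^ z)))
                (cong suc (ℕP.+-suc a σ)) ⟩
      w * (+ ((suc a ℕ.+ σ) C σ) * (x ^ (suc b ∸ σ) * w ^ (suc (suc a) ℕ.+ σ)))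
        + w * (+ ((a ℕ.+ suc σ) C suc σ) * (x ^ (suc b ∸ σ) * w ^ (suc (suc a) ℕ.+ σ)))
        ≡⟨ collect w (+ ((suc a ℕ.+ σ) C σ)) (+ ((a ℕ.+ suc σ) C suc σ)) (x ^ (suc b ∸ σ)) (w ^ (suc (suc a) ℕ.+ σ)) ⟩
      (+ ((suc a ℕ.+ σ) C σ) + + ((a ℕ.+ suc σ) C suc σ)) * (x ^ (suc b ∸ σ) * (w * w ^ (suc (suc a) ℕ.+ σ)))
        ≡⟨ cong₂ (λ c z → c * (x ^ (suc b ∸ σ) * w ^ z)) (pascal a σ) (sym (ℕP.+-suc (suc (suc a)) σ)) ⟩
      g (suc σ) ∎

  pfSum-b1 : ∀ v w a → pfSum v w (suc a) 1 ≡ v * w ^ suc a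
  pfSum-b1 v w a = trans (ℤP.+-identityʳ _) (trans (ℤP.*-identityˡ _)
    (cong₂ _*_ (ℤP.*-identityʳ v) (cong (λ z → w ^ suc z) (ℕP.+-identityʳ a))))

  pfSum-a1 : ∀ u w a → pfSum u w 1 (suc a) ≡ Σ (upTo (suc a)) (λ τ → u ^ (suc a ∸ τ) * w ^ suc τ)
  pfSum-a1 u w a = Σ-cong≡ (upTo (suc a)) (λ τ →
    trans (cong (λ c → + c * (u ^ (suc a ∸ τ) * w ^ suc τ)) (nCn≡1 τ)) (ℤP.*-identityˡ _))

  pfSum-w0 : ∀ x a b → pfSum x (+ 0) (suc a) b ≡ + 0
  pfSum-w0 x a b = trans (Σ-cong≡ (upTo b) vanish) (Σ-0 (upTo b))
    where
    vanish : ∀ τ → + ((a ℕ.+ τ) C τ) * (x ^ (b ∸ τ) * (+ 0) ^ (suc a ℕ.+ τ)) ≡ + 0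
    vanish τ = trans (cong (+ ((a ℕ.+ τ) C τ) *_) (ℤP.*-zeroʳ (x ^ (b ∸ τ)))) (ℤP.*-zeroʳ (+ ((a ℕ.+ τ) C τ)))

open PartialFractionSums

module AtPrime (p : ℕ) (pr : Prime p) where
  open Int using (_+_; _*_; -_; _-_; _^_)

  -- Congruence of integers modulo p; a record so that Agda does not unfold it.
  infix 4 _≈_
  record _≈_ (a b : ℤ) : Set where
    constructor mk≈
    field divides-difference : + p ℤD.∣ (a - b)
  open _≈_

  ≡⇒≈ : ∀ {a b} → a ≡ b → a ≈ b
  ≡⇒≈ {a} refl = mk≈ (subst (+ p ℤD.∣_) (sym (ℤP.+-inverseʳ a)) (ℤD.divides (+ 0) refl))

  ≈-refl : ∀ {a} → a ≈ a
  ≈-refl = ≡⇒≈ refl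

  ≈-sym : ∀ {a b} → a ≈ b → b ≈ a
  ≈-sym {a} {b} (mk≈ h) = mk≈ (subst (+ p ℤD.∣_) (negate-diff a b) (ℤD.∣m⇒∣-m h))
    where
    negate-diff : ∀ a b → - (a - b) ≡ b - a
    negate-diff = solve-∀

  ≈-trans : ∀ {a b c} → a ≈ b → b ≈ c → a ≈ c
  ≈-trans {a} {b} {c} (mk≈ h) (mk≈ k) = mk≈ (subst (+ p ℤD.∣_) (telescope a b c) (ℤD.∣m∣n⇒∣m+n h k))
    where
    telescope : ∀ a b c → (a - b) + (b - c) ≡ a - c
    telescope = solve-∀

  +-cong : ∀ {a b c d} → a ≈ b → c ≈ d → a + c ≈ b + d
  +-cong {a} {b} {c} {d} (mk≈ h) (mk≈ k) = mk≈ (subst (+ p ℤD.∣_) (regroup a b c d) (ℤD.∣m∣n⇒∣m+n h k))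
    where
    regroup : ∀ a b c d → (a - b) + (c - d) ≡ (a + c) - (b + d)
    regroup = solve-∀

  *-cong : ∀ {a b c d} → a ≈ b → c ≈ d → a * c ≈ b * d
  *-cong {a} {b} {c} {d} (mk≈ h) (mk≈ k) =
    mk≈ (subst (+ p ℤD.∣_) (regroup a b c d) (ℤD.∣m∣n⇒∣m+n (ℤD.∣m⇒∣m*n c h) (ℤD.∣n⇒∣m*n b k)))
    where
    regroup : ∀ a b c d → (a - b) * c + b * (c - d) ≡ a * c - b * d
    regroup = solve-∀

  neg-cong : ∀ {a b} → a ≈ b → - a ≈ - b
  neg-cong {a} {b} (mk≈ h) = mk≈ (subst (+ p ℤD.∣_) (regroup a b) (ℤD.∣m⇒∣-m h))
    where
    regroup : ∀ a b → - (a - b) ≡ - a - - b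
    regroup = solve-∀

  ^-cong : ∀ e {a b} → a ≈ b → a ^ e ≈ b ^ e
  ^-cong zero h = ≈-refl
  ^-cong (suc e) h = *-cong h (^-cong e h)

  ∣⇒≈0 : ∀ {a} → + p ℤD.∣ a → a ≈ + 0
  ∣⇒≈0 {a} h = mk≈ (subst (+ p ℤD.∣_) (sym (ℤP.+-identityʳ a)) h)

  ≈-setoid : Setoid _ _
  ≈-setoid = record { Carrier = ℤ ; _≈_ = _≈_ ;
    isEquivalence = record { refl = ≈-refl ; sym = ≈-sym ; trans = ≈-trans } }

  module ≈-Reasoning where
    open import Relation.Binary.Reasoning.Setoid ≈-setoid public
      renaming (begin_ to ≈begin_; _∎ to _≈∎) using (step-≈-⟩; step-≈-⟨; step-≡-⟩; step-≡-⟨; step-≡-∣)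

  p>1 : 1 < p
  p>1 = ℕ.nonTrivial⇒n>1 p {{prime⇒nonTrivial pr}}

  p∤1 : ¬ (p ℕD.∣ 1)
  p∤1 h with ℕD.∣1⇒≡1 h
  ... | refl = ¬prime[1] pr

  p∤* : ∀ {m n} → ¬ (p ℕD.∣ m) → ¬ (p ℕD.∣ n) → ¬ (p ℕD.∣ m ℕ.* n)
  p∤* {m} {n} p∤m p∤n h with euclidsLemma m n pr h
  ... | inj₁ p∣m = p∤m p∣m
  ... | inj₂ p∣n = p∤n p∣n

  p∤⇒coprime : ∀ {n} → ¬ (p ℕD.∣ n) → Coprime n p
  p∤⇒coprime {n} h {d} (d∣n , d∣p) with prime⇒irreducible pr d∣p
  ... | inj₁ d≡1 = d≡1
  ... | inj₂ refl = ⊥-elim (h d∣n)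

  p∣⇒¬coprime : ∀ {n} → p ℕD.∣ n → ¬ Coprime n p
  p∣⇒¬coprime {n} h c with c (h , ℕD.∣-refl)
  ... | refl = ¬prime[1] pr

  ≈-resp-∣ : ∀ {m n} → + m ≈ + n → p ℕD.∣ m → p ℕD.∣ n
  ≈-resp-∣ {m} {n} (mk≈ h) p∣m =
    ℤD.∣⇒∣ᵤ (subst (+ p ℤD.∣_) (cancel (+ m) (+ n)) (ℤD.∣m∣n⇒∣m-n (ℤD.∣ᵤ⇒∣ {k = + p} {i = + m} p∣m) h))
    where
    cancel : ∀ a b → a - (a - b) ≡ b
    cancel = solve-∀

  p∣⇒≈0 : ∀ {n} → p ℕD.∣ n → + n ≈ + 0
  p∣⇒≈0 h = ∣⇒≈0 (ℤD.∣ᵤ⇒∣ h)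

  +-p∣ˡ : ∀ {X Y} → p ℕD.∣ X → + (X ℕ.+ Y) ≈ + Y
  +-p∣ˡ {X} {Y} h = ≈-trans (≡⇒≈ (ℤP.pos-+ X Y))
    (≈-trans (+-cong (p∣⇒≈0 h) (≈-refl {+ Y})) (≡⇒≈ (ℤP.+-identityˡ (+ Y))))

  +-p∣ʳ : ∀ {X Y} → p ℕD.∣ Y → + (X ℕ.+ Y) ≈ + X
  +-p∣ʳ {X} {Y} h = ≈-trans (≡⇒≈ (cong +_ (ℕP.+-comm X Y))) (+-p∣ˡ {Y} {X} h)

  -- The reciprocal of n modulo p, read off a Bézout identity; 0 when p ∣ n.
  recip : ℕ → ℤ
  recip n with coprime? n p
  ... | no _ = + 0
  ... | yes c with coprime-Bézout c
  ...   | Bézout.+- x y eq = + x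
  ...   | Bézout.-+ x y eq = - (+ x)

  recip-zero : ∀ {n} → p ℕD.∣ n → recip n ≡ + 0
  recip-zero {n} h with coprime? n p
  ... | no _ = refl
  ... | yes c = ⊥-elim (p∣⇒¬coprime h c)

  recip-inv : ∀ {n} → ¬ (p ℕD.∣ n) → (+ n) * recip n ≈ + 1
  recip-inv {n} h with coprime? n p
  ... | no nc = ⊥-elim (nc (p∤⇒coprime h))
  ... | yes c with coprime-Bézout c
  ...   | Bézout.+- x y eq = mk≈ (subst (+ p ℤD.∣_) e (ℤD.divides (+ y) refl))
    where
    open ≡-Reasoning
    add-sub : ∀ a → a ≡ (+ 1 + a) - + 1
    add-sub = solve-∀
    e : + y * + p ≡ + n * + x - + 1
    e = begin
      + y * + p                ≡⟨ add-sub (+ y * + p) ⟩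
      (+ 1 + + y * + p) - + 1  ≡⟨ cong (_- + 1) (trans (sym (trans (ℤP.pos-+ 1 (y ℕ.* p))
                                   (cong (_+_ (+ 1)) (ℤP.pos-* y p)))) (cong +_ eq)) ⟩
      + (x ℕ.* n) - + 1        ≡⟨ cong (_- + 1) (trans (cong +_ (ℕP.*-comm x n)) (ℤP.pos-* n x)) ⟩
      + n * + x - + 1 ∎
  ...   | Bézout.-+ x y eq = mk≈ (subst (+ p ℤD.∣_) e (ℤD.divides (- + y) refl))
    where
    open ≡-Reasoning
    neg-succ : ∀ a b → - (+ 1 + a * b) ≡ a * (- b) - + 1
    neg-succ = solve-∀
    e : - + y * + p ≡ + n * - (+ x) - + 1
    e = begin
      - + y * + p          ≡⟨ ℤP.neg-distribˡ-* (+ y) (+ p) ⟨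
      - (+ y * + p)        ≡⟨ cong -_ (trans (sym (ℤP.pos-* y p)) (cong +_ (sym eq))) ⟩
      - (+ (1 ℕ.+ x ℕ.* n)) ≡⟨ cong -_ (ℤP.pos-+ 1 (x ℕ.* n)) ⟩
      - (+ 1 + + (x ℕ.* n)) ≡⟨ cong (λ z → - (+ 1 + z)) (trans (cong +_ (ℕP.*-comm x n)) (ℤP.pos-* n x)) ⟩
      - (+ 1 + + n * + x)  ≡⟨ neg-succ (+ n) (+ x) ⟩
      + n * - (+ x) - + 1 ∎

  recip-unique : ∀ {n z} → ¬ (p ℕD.∣ n) → (+ n) * z ≈ + 1 → recip n ≈ z
  recip-unique {n} {z} h e = ≈begin
      recip n                   ≡⟨ ℤP.*-identityʳ (recip n) ⟨
      recip n * + 1             ≈⟨ *-cong (≈-refl {recip n}) (≈-sym e) ⟩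
      recip n * (+ n * z)       ≡⟨ swap (recip n) (+ n) z ⟩
      (+ n * recip n) * z       ≈⟨ *-cong (recip-inv h) (≈-refl {z}) ⟩
      + 1 * z                   ≡⟨ ℤP.*-identityˡ z ⟩
      z ≈∎
    where
    open ≈-Reasoning
    swap : ∀ a b c → a * (b * c) ≡ (b * a) * c
    swap = solve-∀

  recip-cong : ∀ {m n} → + m ≈ + n → recip m ≈ recip n
  recip-cong {m} {n} e with p ℕD.∣? m
  ... | yes pm = ≡⇒≈ (trans (recip-zero pm) (sym (recip-zero (≈-resp-∣ e pm))))
  ... | no pm = ≈-sym (recip-unique (λ pn → pm (≈-resp-∣ (≈-sym e) pn))
                  (≈-trans (*-cong (≈-sym e) (≈-refl {recip m})) (recip-inv pm)))

  recip-* : ∀ m n → recip (m ℕ.* n) ≈ recip m * recip n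
  recip-* m n with p ℕD.∣? m | p ℕD.∣? n
  ... | yes pm | _ = ≡⇒≈ (trans (recip-zero (ℕD.∣m⇒∣m*n n pm)) (sym (cong (_* recip n) (recip-zero pm))))
  ... | no _ | yes pn = ≡⇒≈ (trans (recip-zero (ℕD.∣n⇒∣m*n m pn))
                          (sym (trans (cong (recip m *_) (recip-zero pn)) (ℤP.*-zeroʳ (recip m)))))
  ... | no pm | no pn = recip-unique (p∤* pm pn) (≈begin
        + (m ℕ.* n) * (recip m * recip n) ≡⟨ cong (_* (recip m * recip n)) (ℤP.pos-* m n) ⟩
        (+ m * + n) * (recip m * recip n) ≡⟨ interchange (+ m) (+ n) (recip m) (recip n) ⟩
        (+ m * recip m) * (+ n * recip n) ≈⟨ *-cong (recip-inv pm) (recip-inv pn) ⟩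
        + 1 ≈∎)
    where
    open ≈-Reasoning
    interchange : ∀ a b c d → (a * b) * (c * d) ≡ (a * c) * (b * d)
    interchange = solve-∀

  recip-1 : recip 1 ≈ + 1
  recip-1 = recip-unique p∤1 ≈-refl

  recip-^ : ∀ m e → recip (m ℕ.^ e) ≈ recip m ^ e
  recip-^ m zero = recip-1
  recip-^ m (suc e) = ≈-trans (recip-* m (m ℕ.^ e)) (*-cong (≈-refl {recip m}) (recip-^ m e))

  recip-neg : ∀ {m n} → p ℕD.∣ (m ℕ.+ n) → recip m ≈ - recip n
  recip-neg {m} {n} h with p ℕD.∣? n
  ... | yes pn = ≡⇒≈ (trans (recip-zero (ℕD.∣m+n∣m⇒∣n (subst (p ℕD.∣_) (ℕP.+-comm m n) h) pn))
                       (sym (cong -_ (recip-zero pn))))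
  ... | no pn = recip-unique (λ pm → pn (ℕD.∣m+n∣m⇒∣n h pm)) (≈begin
        + m * (- recip n)       ≡⟨ move-sign (+ m) (recip n) ⟩
        (- + m) * recip n       ≈⟨ *-cong (neg-cong m≈-n) (≈-refl {recip n}) ⟩
        (- - + n) * recip n     ≡⟨ cong (_* recip n) (ℤP.neg-involutive (+ n)) ⟩
        + n * recip n           ≈⟨ recip-inv pn ⟩
        + 1 ≈∎)
    where
    open ≈-Reasoning
    move-sign : ∀ a b → a * (- b) ≡ (- a) * b
    move-sign = solve-∀
    as-difference : ∀ a b → a + b ≡ a - (- b)
    as-difference = solve-∀
    m≈-n : + m ≈ - + n
    m≈-n = mk≈ (subst (+ p ℤD.∣_) (trans (ℤP.pos-+ m n) (as-difference (+ m) (+ n))) (ℤD.∣ᵤ⇒∣ h))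

  Σ-cong : ∀ {A : Set} (xs : List A) {f g : A → ℤ} → (∀ x → f x ≈ g x) → Σ xs f ≈ Σ xs g
  Σ-cong [] h = ≈-refl
  Σ-cong (x ∷ xs) h = +-cong (h x) (Σ-cong xs h)

  Σ-cong∈ : ∀ {A : Set} (xs : List A) {f g : A → ℤ} → (∀ x → x ∈ xs → f x ≈ g x) → Σ xs f ≈ Σ xs g
  Σ-cong∈ [] h = ≈-refl
  Σ-cong∈ (x ∷ xs) h = +-cong (h x (here refl)) (Σ-cong∈ xs (λ y y∈ → h y (there y∈)))

  Σ-zero : ∀ {A : Set} (xs : List A) {f : A → ℤ} → (∀ x → x ∈ xs → f x ≈ + 0) → Σ xs f ≈ + 0
  Σ-zero xs h = ≈-trans (Σ-cong∈ xs h) (≡⇒≈ (Σ-0 xs))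

  Σ-delta : ∀ n x₀ (f : ℕ → ℤ) → x₀ < n → (∀ x → x < n → x ≢ x₀ → f x ≈ + 0) → Σ (upTo n) f ≈ f x₀
  Σ-delta (suc n) x₀ f x₀<n h with x₀ ℕ.≟ n
  ... | yes refl = ≈begin
        Σ (upTo (suc n)) f   ≡⟨ Σ-upTo-suc n f ⟩
        Σ (upTo n) f + f n   ≈⟨ +-cong (Σ-zero (upTo n) (λ x x∈ → let x<n = ∈-upTo⁻ x∈ in
                                  h x (ℕP.m<n⇒m<1+n x<n) (λ e → ℕP.<-irrefl e x<n))) (≈-refl {f n}) ⟩
        + 0 + f n            ≡⟨ ℤP.+-identityˡ (f n) ⟩
        f n ≈∎
    where open ≈-Reasoning
  ... | no x₀≢n = ≈begin
        Σ (upTo (suc n)) f   ≡⟨ Σ-upTo-suc n f ⟩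
        Σ (upTo n) f + f n   ≈⟨ +-cong (Σ-delta n x₀ f (ℕP.≤∧≢⇒< (ℕP.≤-pred x₀<n) x₀≢n)
                                          (λ x x<n → h x (ℕP.m<n⇒m<1+n x<n)))
                                       (h n ℕP.≤-refl (λ e → x₀≢n (sym e))) ⟩
        f x₀ + + 0           ≡⟨ ℤP.+-identityʳ (f x₀) ⟩
        f x₀ ≈∎
    where open ≈-Reasoning

  -- The reading of a fraction a/b in ℤ/p, and of a polynomial as its coefficient
  -- function.  'Good' fractions have denominator prime to p; only for them is
  -- the reading additive and faithful.
  val : Frac → ℤ
  val (a , b) = a * recip b

  Good : Frac → Set
  Good (a , b) = ¬ (p ℕD.∣ b)

  GoodP : Poly → Set
  GoodP = All (λ ec → Good (proj₂ ec))

  good-+ : ∀ {x y} → Good x → Good y → Good (x +f y)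
  good-+ {a , b} {c , d} gx gy = p∤* gx gy

  good-* : ∀ {x y} → Good x → Good y → Good (x *f y)
  good-* {a , b} {c , d} gx gy = p∤* gx gy

  good-ι : ∀ z → Good (ι z)
  good-ι z = p∤1

  val-* : ∀ x y → val (x *f y) ≈ val x * val y
  val-* (a , b) (c , d) = ≈begin
      (a * c) * recip (b ℕ.* d)        ≈⟨ *-cong (≈-refl {a * c}) (recip-* b d) ⟩
      (a * c) * (recip b * recip d)    ≡⟨ interchange a c (recip b) (recip d) ⟩
      (a * recip b) * (c * recip d) ≈∎
    where
    open ≈-Reasoning
    interchange : ∀ a c x y → (a * c) * (x * y) ≡ (a * x) * (c * y)
    interchange = solve-∀

  val-+ : ∀ x y → Good x → Good y → val (x +f y) ≈ val x + val y
  val-+ (a , b) (c , d) gx gy = ≈begin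
      (a * + d + c * + b) * recip (b ℕ.* d)
        ≈⟨ *-cong (≈-refl {a * + d + c * + b}) (recip-* b d) ⟩
      (a * + d + c * + b) * (recip b * recip d)
        ≡⟨ expand a c (+ d) (+ b) (recip b) (recip d) ⟩
      (a * recip b) * (+ d * recip d) + (c * recip d) * (+ b * recip b)
        ≈⟨ +-cong (*-cong (≈-refl {a * recip b}) (recip-inv gy)) (*-cong (≈-refl {c * recip d}) (recip-inv gx)) ⟩
      (a * recip b) * + 1 + (c * recip d) * + 1
        ≡⟨ cong₂ _+_ (ℤP.*-identityʳ (a * recip b)) (ℤP.*-identityʳ (c * recip d)) ⟩
      a * recip b + c * recip d ≈∎
    where
    open ≈-Reasoning
    expand : ∀ a c D B x y → (a * D + c * B) * (x * y) ≡ (a * x) * (D * y) + (c * y) * (B * x)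
    expand = solve-∀

  val-ι : ∀ z → val (ι z) ≈ z
  val-ι z = ≈-trans (*-cong (≈-refl {z}) recip-1) (≡⇒≈ (ℤP.*-identityʳ z))

  val-inv : ∀ d → val (inv d) ≈ recip d
  val-inv d = ≡⇒≈ (ℤP.*-identityˡ (recip d))

  ≈⇒≡[p] : ∀ x y → Good x → Good y → val x ≈ val y → x ≡[ p ] y
  ≈⇒≡[p] (a , b) (c , d) gx gy e = ℤD.∣⇒∣ᵤ (divides-difference cross)
    where
    open ≈-Reasoning
    cross : a * + d ≈ c * + b
    cross = ≈begin
      a * + d                            ≡⟨ ℤP.*-identityʳ (a * + d) ⟨
      (a * + d) * + 1                    ≈⟨ *-cong (≈-refl {a * + d}) (≈-sym (recip-inv gx)) ⟩
      (a * + d) * (+ b * recip b)        ≡⟨ regroupˡ a (recip b) (+ b) (+ d) ⟩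
      a * recip b * (+ b * + d)          ≈⟨ *-cong e (≈-refl {+ b * + d}) ⟩
      c * recip d * (+ b * + d)          ≡⟨ regroupʳ c (recip d) (+ b) (+ d) ⟩
      (c * + b) * (+ d * recip d)        ≈⟨ *-cong (≈-refl {c * + b}) (recip-inv gy) ⟩
      (c * + b) * + 1                    ≡⟨ ℤP.*-identityʳ (c * + b) ⟩
      c * + b ≈∎
      where
      regroupˡ : ∀ a x B D → (a * D) * (B * x) ≡ a * x * (B * D)
      regroupˡ = solve-∀
      regroupʳ : ∀ c y B D → c * y * (B * D) ≡ (c * B) * (D * y)
      regroupʳ = solve-∀

  -- ⟦ P ⟧⁺ e n: the n-th coefficient of T^e · P.
  δ : ℕ → ℕ → ℤ
  δ e n = if does (e ℕ.≟ n) then + 1 else + 0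

  ⟦_⟧⁺ : Poly → ℕ → ℕ → ℤ
  ⟦ P ⟧⁺ e n = Σ P (λ ec → δ (e ℕ.+ proj₁ ec) n * val (proj₂ ec))

  ⟦_⟧ : Poly → ℕ → ℤ
  ⟦ P ⟧ = ⟦ P ⟧⁺ 0

  coeff-good : ∀ n P → GoodP P → Good (coeff n P)
  coeff-good n [] g = p∤1
  coeff-good n ((e , c) ∷ P) (gc ∷ g) with does (e ℕ.≟ n)
  ... | true = good-+ {c} {coeff n P} gc (coeff-good n P g)
  ... | false = coeff-good n P g

  coeff-val : ∀ n P → GoodP P → val (coeff n P) ≈ ⟦ P ⟧ n
  coeff-val n [] g = ≈-refl
  coeff-val n ((e , c) ∷ P) (gc ∷ g) with does (e ℕ.≟ n)
  ... | true = ≈-trans (val-+ c (coeff n P) gc (coeff-good n P g))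
                (+-cong (≡⇒≈ (sym (ℤP.*-identityˡ (val c)))) (coeff-val n P g))
  ... | false = ≈-trans (coeff-val n P g) (≡⇒≈ (sym (ℤP.+-identityˡ _)))

  ⟦⊕⟧ : ∀ P Q n → ⟦ P ⊕ Q ⟧ n ≡ ⟦ P ⟧ n + ⟦ Q ⟧ n
  ⟦⊕⟧ P Q n = Σ-++ P Q _

  ⟦scale⟧ : ∀ c P n → ⟦ scale c P ⟧ n ≈ val c * ⟦ P ⟧ n
  ⟦scale⟧ c [] n = ≡⇒≈ (sym (ℤP.*-zeroʳ (val c)))
  ⟦scale⟧ c ((e , d) ∷ P) n = ≈begin
      δ (0 ℕ.+ e) n * val (c *f d) + ⟦ scale c P ⟧ n
        ≈⟨ +-cong (*-cong (≈-refl {δ e n}) (val-* c d)) (⟦scale⟧ c P n) ⟩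
      δ e n * (val c * val d) + val c * ⟦ P ⟧ n
        ≡⟨ cong (_+ val c * ⟦ P ⟧ n) (swap (δ e n) (val c) (val d)) ⟩
      val c * (δ e n * val d) + val c * ⟦ P ⟧ n
        ≡⟨ ℤP.*-distribˡ-+ (val c) _ _ ⟨
      val c * ⟦ (e , d) ∷ P ⟧ n ≈∎
    where
    open ≈-Reasoning
    swap : ∀ d a b → d * (a * b) ≡ a * (d * b)
    swap = solve-∀

  ⟦⊖⟧ : ∀ P n → ⟦ ⊖ P ⟧ n ≈ - ⟦ P ⟧ n
  ⟦⊖⟧ P n = ≈-trans (⟦scale⟧ (ι (- + 1)) P n)
             (≈-trans (*-cong (val-ι (- + 1)) (≈-refl {⟦ P ⟧ n})) (≡⇒≈ (ℤP.-1*i≡-i (⟦ P ⟧ n))))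

  ⟦sumP⟧ : ∀ Ps n → ⟦ sumP Ps ⟧ n ≡ Σ Ps (λ P → ⟦ P ⟧ n)
  ⟦sumP⟧ [] n = refl
  ⟦sumP⟧ (P ∷ Ps) n = trans (⟦⊕⟧ P (sumP Ps) n) (cong (_+_ (⟦ P ⟧ n)) (⟦sumP⟧ Ps n))

  ⟦⊛⟧ : ∀ P Q n → ⟦ P ⊛ Q ⟧ n ≈ Σ P (λ ec → val (proj₂ ec) * ⟦ Q ⟧⁺ (proj₁ ec) n)
  ⟦⊛⟧ [] Q n = ≈-refl
  ⟦⊛⟧ ((e , c) ∷ P) Q n = ≈-trans (≡⇒≈ (Σ-++ (shifted Q) (P ⊛ Q) _)) (+-cong (monomial-times Q) (⟦⊛⟧ P Q n))
    where
    open ≈-Reasoning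
    shifted : Poly → Poly
    shifted = map (λ ed → (e ℕ.+ proj₁ ed , c *f proj₂ ed))
    swap : ∀ d a b → d * (a * b) ≡ a * (d * b)
    swap = solve-∀
    monomial-times : ∀ Q → ⟦ shifted Q ⟧ n ≈ val c * ⟦ Q ⟧⁺ e n
    monomial-times [] = ≡⇒≈ (sym (ℤP.*-zeroʳ (val c)))
    monomial-times ((e' , d) ∷ Q) = ≈begin
      δ (e ℕ.+ e') n * val (c *f d) + ⟦ shifted Q ⟧ n
        ≈⟨ +-cong (*-cong (≈-refl {δ (e ℕ.+ e') n}) (val-* c d)) (monomial-times Q) ⟩
      δ (e ℕ.+ e') n * (val c * val d) + val c * ⟦ Q ⟧⁺ e n
        ≡⟨ cong (_+ val c * ⟦ Q ⟧⁺ e n) (swap (δ (e ℕ.+ e') n) (val c) (val d)) ⟩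
      val c * (δ (e ℕ.+ e') n * val d) + val c * ⟦ Q ⟧⁺ e n
        ≡⟨ ℤP.*-distribˡ-+ (val c) _ _ ⟨
      val c * ⟦ (e' , d) ∷ Q ⟧⁺ e n ≈∎

  goodP-⊕ : ∀ {P Q} → GoodP P → GoodP Q → GoodP (P ⊕ Q)
  goodP-⊕ = AllP.++⁺

  goodP-scale : ∀ c P → Good c → GoodP P → GoodP (scale c P)
  goodP-scale c [] gc [] = []
  goodP-scale c ((e , d) ∷ P) gc (gd ∷ g) = good-* {c} {d} gc gd ∷ goodP-scale c P gc g

  goodP-⊛ : ∀ P Q → GoodP P → GoodP Q → GoodP (P ⊛ Q)
  goodP-⊛ [] Q gp gq = []
  goodP-⊛ ((e , c) ∷ P) Q (gc ∷ gp) gq = AllP.++⁺ (shifted Q gq) (goodP-⊛ P Q gp gq)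
    where
    shifted : ∀ Q → GoodP Q → GoodP (map (λ ed → (e ℕ.+ proj₁ ed , c *f proj₂ ed)) Q)
    shifted [] [] = []
    shifted ((e' , d) ∷ Q) (gd ∷ g) = good-* {c} {d} gc gd ∷ shifted Q g

  goodP-concatMap : ∀ {A : Set} (g : A → Poly) xs → (∀ x → GoodP (g x)) → GoodP (concatMap g xs)
  goodP-concatMap g [] h = []
  goodP-concatMap g (x ∷ xs) h = AllP.++⁺ (h x) (goodP-concatMap g xs h)

  goodP-sumP-map : ∀ {A : Set} (g : A → Poly) xs → (∀ x → GoodP (g x)) → GoodP (sumP (map g xs))
  goodP-sumP-map g [] h = []
  goodP-sumP-map g (x ∷ xs) h = AllP.++⁺ (h x) (goodP-sumP-map g xs h)

  goodP-⊖ : ∀ P → GoodP P → GoodP (⊖ P)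
  goodP-⊖ P = goodP-scale (ι (- + 1)) P (good-ι (- + 1))

  Wf : List ℕ → List ℕ → ℤ
  Wf [] E = + 1
  Wf (f ∷ F) [] = + 1
  Wf (f ∷ F) (e ∷ E) = recip f ^ e * Wf F E

  W : ℕ → List ℕ → List ℕ → ℤ
  W s t E = Wf (PS s t) E

  recip-denom : ∀ F E → recip (denom F E) ≈ Wf F E
  recip-denom [] E = recip-1
  recip-denom (f ∷ F) [] = recip-1
  recip-denom (f ∷ F) (e ∷ E) =
    ≈-trans (recip-* (f ℕ.^ e) (denom F E)) (*-cong (recip-^ f e) (recip-denom F E))

  good-denom : ∀ F E → primeToAll p F ≡ true → ¬ (p ℕD.∣ denom F E)
  good-denom [] E h = p∤1
  good-denom (f ∷ F) [] h = p∤1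
  good-denom (f ∷ F) (e ∷ E) h with p ℕD.∣? f
  ... | no p∤f = p∤* (p∤^ e) (good-denom F E h)
    where
    p∤^ : ∀ e → ¬ (p ℕD.∣ f ℕ.^ e)
    p∤^ zero = p∤1
    p∤^ (suc e) = p∤* p∤f (p∤^ e)

  -- A term excluded by the primed sum has weight 0, since all exponents are positive.
  Wf-excluded : ∀ F E → primeToAll p F ≡ false → length F ≡ length E → All (0 <_) E → Wf F E ≡ + 0
  Wf-excluded (f ∷ F) (e ∷ E) h l (e>0 ∷ a) with p ℕD.∣? f
  ... | yes p∣f = trans (cong (λ z → z ^ e * Wf F E) (recip-zero p∣f)) (zero-power e e>0)
    where
    zero-power : ∀ e → 0 < e → (+ 0) ^ e * Wf F E ≡ + 0
    zero-power (suc e) _ = refl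
  ... | no _ = trans (cong (recip f ^ e *_) (Wf-excluded F E h (ℕP.suc-injective l) a))
                     (ℤP.*-zeroʳ (recip f ^ e))

  Wf-++ : ∀ F₁ F₂ E₁ E₂ → length F₁ ≡ length E₁ → Wf (F₁ ++ F₂) (E₁ ++ E₂) ≡ Wf F₁ E₁ * Wf F₂ E₂
  Wf-++ [] F₂ [] E₂ l = sym (ℤP.*-identityˡ _)
  Wf-++ (f ∷ F₁) F₂ (e ∷ E₁) E₂ l =
    trans (cong (recip f ^ e *_) (Wf-++ F₁ F₂ E₁ E₂ (ℕP.suc-injective l)))
          (sym (ℤP.*-assoc (recip f ^ e) (Wf F₁ E₁) (Wf F₂ E₂)))

  W-++ : ∀ s t u E F → length t ≡ length E → W s (t ++ u) (E ++ F) ≡ W s t E * W (s ℕ.+ sum t) u F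
  W-++ s t u E F l = trans (cong (λ z → Wf z (E ++ F)) (PS-++ s t u))
                      (Wf-++ (PS s t) (PS (s ℕ.+ sum t) u) E F (trans (length-PS s t) l))

  W-∷ʳ : ∀ s t x E e → length t ≡ length E → W s (t ∷ʳ x) (E ∷ʳ e) ≡ W s t E * recip (s ℕ.+ sum t ℕ.+ x) ^ e
  W-∷ʳ s t x E e l = trans (W-++ s t [ x ] E [ e ] l) (cong (W s t E *_) (ℤP.*-identityʳ _))

  W-shift : ∀ s s' t E → + s ≈ + s' → W s t E ≈ W s' t E
  W-shift s s' [] E h = ≈-refl
  W-shift s s' (x ∷ t) [] h = ≈-refl
  W-shift s s' (x ∷ t) (e ∷ E) h = *-cong (^-cong e (recip-cong h')) (W-shift (s ℕ.+ x) (s' ℕ.+ x) t E h')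
    where
    h' : + (s ℕ.+ x) ≈ + (s' ℕ.+ x)
    h' = ≈-trans (≡⇒≈ (ℤP.pos-+ s x)) (≈-trans (+-cong h (≈-refl {+ x})) (≡⇒≈ (sym (ℤP.pos-+ s' x))))

  InR : ℕ → Set
  InR x = 0 < x × x < p

  R : List ℕ
  R = range p

  T : ℕ → List (List ℕ)
  T r = tuples p r

  p∸1+1≡p : p ∸ 1 ℕ.+ 1 ≡ p
  p∸1+1≡p = ℕP.m∸n+n≡m (ℕP.<⇒≤ p>1)

  range-InR : ∀ {x} → x ∈ R → InR x
  range-InR x∈ with ∈-map⁻ suc x∈
  ... | i , i∈ , refl = s≤s z≤n , ℕP.≤-trans (s≤s (∈-upTo⁻ i∈)) (ℕP.≤-reflexive (trans (ℕP.+-comm 1 (p ∸ 1)) p∸1+1≡p))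

  InR⇒≤ : ∀ {x} → InR x → x ≤ p ∸ 1
  InR⇒≤ (_ , x<p) = ℕP.≤-pred (ℕP.≤-trans x<p (ℕP.≤-reflexive (sym (trans (ℕP.+-comm 1 (p ∸ 1)) p∸1+1≡p))))

  sum-InR≤ : ∀ t r → length t ≡ r → All InR t → sum t ≤ r ℕ.* (p ∸ 1)
  sum-InR≤ [] zero _ _ = z≤n
  sum-InR≤ (x ∷ t) (suc r) l (ix ∷ a) = ℕP.+-mono-≤ (InR⇒≤ ix) (sum-InR≤ t r (ℕP.suc-injective l) a)

  ΣT-∷ : ∀ r (f : List ℕ → ℤ) → Σ (T (suc r)) f ≡ Σ R (λ x → Σ (T r) (λ t → f (x ∷ t)))
  ΣT-∷ r f = trans (Σ-concatMap (λ l → map (l ∷_) (T r)) R f) (Σ-cong≡ R (λ x → Σ-map (x ∷_) (T r) f))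

  ΣT-cong : ∀ r {f g : List ℕ → ℤ} → (∀ t → length t ≡ r → All InR t → f t ≈ g t) → Σ (T r) f ≈ Σ (T r) g
  ΣT-cong zero {f} {g} h = +-cong (h [] refl []) ≈-refl
  ΣT-cong (suc r) {f} {g} h = ≈-trans (≡⇒≈ (ΣT-∷ r f)) (≈-trans
      (Σ-cong∈ R (λ x x∈ → ΣT-cong r (λ t l a → h (x ∷ t) (cong suc l) (range-InR x∈ ∷ a))))
      (≡⇒≈ (sym (ΣT-∷ r g))))

  ΣT-∷ʳ : ∀ r (f : List ℕ → ℤ) → Σ (T (suc r)) f ≡ Σ (T r) (λ t → Σ R (λ x → f (t ∷ʳ x)))
  ΣT-∷ʳ zero f = trans (ΣT-∷ 0 f) (trans (Σ-cong≡ R (λ x → ℤP.+-identityʳ (f [ x ])))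
                     (sym (ℤP.+-identityʳ (Σ R (λ x → f [ x ])))))
  ΣT-∷ʳ (suc r) f = trans (ΣT-∷ (suc r) f) (trans (Σ-cong≡ R (λ x → ΣT-∷ʳ r (λ t → f (x ∷ t))))
                        (sym (ΣT-∷ r (λ t → Σ R (λ y → f (t ∷ʳ y))))))

  ΣT-++ : ∀ r s (f : List ℕ → ℤ) → Σ (T (r ℕ.+ s)) f ≡ Σ (T r) (λ u → Σ (T s) (λ v → f (u ++ v)))
  ΣT-++ zero s f = sym (ℤP.+-identityʳ _)
  ΣT-++ (suc r) s f = trans (ΣT-∷ (r ℕ.+ s) f) (trans (Σ-cong≡ R (λ x → ΣT-++ r s (λ t → f (x ∷ t))))
                        (sym (ΣT-∷ r (λ u → Σ (T s) (λ v → f (u ++ v))))))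

  ΣT-reverse : ∀ r (f : List ℕ → ℤ) → Σ (T r) f ≡ Σ (T r) (f ∘ reverse)
  ΣT-reverse zero f = refl
  ΣT-reverse (suc r) f = begin
    Σ (T (suc r)) f                                   ≡⟨ ΣT-∷ r f ⟩
    Σ R (λ x → Σ (T r) (λ t → f (x ∷ t)))             ≡⟨ Σ-cong≡ R (λ x → ΣT-reverse r (λ t → f (x ∷ t))) ⟩
    Σ R (λ x → Σ (T r) (λ t → f (x ∷ reverse t)))     ≡⟨ Σ-comm R (T r) (λ x t → f (x ∷ reverse t)) ⟩
    Σ (T r) (λ t → Σ R (λ x → f (x ∷ reverse t)))     ≡⟨ Σ-cong≡ (T r) (λ t → Σ-cong≡ R (λ x →
                                                           cong f (sym (LP.reverse-++ t [ x ])))) ⟩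
    Σ (T r) (λ t → Σ R (λ x → f (reverse (t ∷ʳ x))))  ≡⟨ ΣT-∷ʳ r (f ∘ reverse) ⟨
    Σ (T (suc r)) (f ∘ reverse) ∎
    where open ≡-Reasoning

  LIsem : List ℕ → List ℕ → List ℕ → ℕ → ℕ → ℤ
  LIsem lam mu nu e n =
    Σ (T (length lam)) λ l → Σ (T (length mu)) λ m → Σ (T (length nu)) λ k →
      δ (e ℕ.+ (sum l ℕ.+ sum m ℕ.+ sum k)) n * (W 0 l lam * (W 0 m mu * W (sum l ℕ.+ sum m) k nu))

  term-sem : ∀ e n E F X → length F ≡ length X → All (0 <_) X →
    ⟦ (if primeToAll p F then [ (E , inv (denom F X)) ] else []) ⟧⁺ e n ≈ δ (e ℕ.+ E) n * Wf F X
  term-sem e n E F X l a with primeToAll p F in eq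
  ... | true = ≈-trans (≡⇒≈ (ℤP.+-identityʳ _)) (*-cong (≈-refl {δ (e ℕ.+ E) n})
                 (≈-trans (val-inv (denom F X)) (recip-denom F X)))
  ... | false = ≡⇒≈ (sym (trans (cong (δ (e ℕ.+ E) n *_) (Wf-excluded F X eq l a)) (ℤP.*-zeroʳ (δ (e ℕ.+ E) n))))

  denominators : List ℕ → List ℕ → List ℕ → List ℕ
  denominators l m k = partialSums l ++ partialSums m ++ map (λ N → sum l ℕ.+ sum m ℕ.+ N) (partialSums k)

  Wf-denominators : ∀ l m k lam mu nu → length l ≡ length lam → length m ≡ length mu →
    Wf (denominators l m k) (lam ++ mu ++ nu) ≡ W 0 l lam * (W 0 m mu * W (sum l ℕ.+ sum m) k nu)
  Wf-denominators l m k lam mu nu ll lm = begin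
    Wf (denominators l m k) (lam ++ mu ++ nu)
      ≡⟨ cong₂ (λ A B → Wf (A ++ B) (lam ++ mu ++ nu)) (partialSums≡PS l)
           (cong₂ _++_ (partialSums≡PS m) (trans (cong (map (λ N → sum l ℕ.+ sum m ℕ.+ N)) (partialSums≡PS k))
              (trans (map-PS (sum l ℕ.+ sum m) 0 k) (cong (λ z → PS z k) (ℕP.+-identityʳ _))))) ⟩
    Wf (PS 0 l ++ PS 0 m ++ PS (sum l ℕ.+ sum m) k) (lam ++ mu ++ nu)
      ≡⟨ Wf-++ (PS 0 l) _ lam _ (trans (length-PS 0 l) ll) ⟩
    W 0 l lam * Wf (PS 0 m ++ PS (sum l ℕ.+ sum m) k) (mu ++ nu)
      ≡⟨ cong (W 0 l lam *_) (Wf-++ (PS 0 m) _ mu _ (trans (length-PS 0 m) lm)) ⟩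
    W 0 l lam * (W 0 m mu * W (sum l ℕ.+ sum m) k nu) ∎
    where open ≡-Reasoning

  length-denominators : ∀ (l m k lam mu nu : List ℕ) → length l ≡ length lam → length m ≡ length mu →
    length k ≡ length nu → length (denominators l m k) ≡ length (lam ++ mu ++ nu)
  length-denominators l m k lam mu nu ll lm lk = begin
    length (denominators l m k)
      ≡⟨ LP.length-++ (partialSums l) ⟩
    length (partialSums l) ℕ.+ length (partialSums m ++ map (λ N → sum l ℕ.+ sum m ℕ.+ N) (partialSums k))
      ≡⟨ cong₂ ℕ._+_ (trans (length-partialSums l) ll) (trans (LP.length-++ (partialSums m))
           (cong₂ ℕ._+_ (trans (length-partialSums m) lm)
              (trans (LP.length-map _ (partialSums k)) (trans (length-partialSums k) lk)))) ⟩
    length lam ℕ.+ (length mu ℕ.+ length nu)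
      ≡⟨ sym (trans (LP.length-++ lam) (cong (length lam ℕ.+_) (LP.length-++ mu))) ⟩
    length (lam ++ mu ++ nu) ∎
    where open ≡-Reasoning

  li-sem : ∀ lam mu nu e n → All (0 <_) (lam ++ mu ++ nu) → ⟦ li lam mu nu p ⟧⁺ e n ≈ LIsem lam mu nu e n
  li-sem lam mu nu e n pos =
    ≈-trans (≡⇒≈ (Σ-concatMap _ (T (length lam)) _)) (ΣT-cong (length lam) λ l ll _ →
    ≈-trans (≡⇒≈ (Σ-concatMap _ (T (length mu)) _)) (ΣT-cong (length mu) λ m lm _ →
    ≈-trans (≡⇒≈ (Σ-concatMap _ (T (length nu)) _)) (ΣT-cong (length nu) λ k lk _ →
    ≈-trans (term-sem e n (sum l ℕ.+ sum m ℕ.+ sum k) (denominators l m k) (lam ++ mu ++ nu)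
                      (length-denominators l m k lam mu nu ll lm lk) pos)
            (≡⇒≈ (cong (δ (e ℕ.+ (sum l ℕ.+ sum m ℕ.+ sum k)) n *_) (Wf-denominators l m k lam mu nu ll lm))))))

  goodP-li : ∀ lam mu nu → GoodP (li lam mu nu p)
  goodP-li lam mu nu = goodP-concatMap _ (T (length lam)) λ l →
    goodP-concatMap _ (T (length mu)) λ m → goodP-concatMap _ (T (length nu)) λ k →
      good-term (sum l ℕ.+ sum m ℕ.+ sum k) (denominators l m k) (lam ++ mu ++ nu)
    where
    good-term : ∀ E F X → GoodP (if primeToAll p F then [ (E , inv (denom F X)) ] else [])
    good-term E F X with primeToAll p F in eq
    ... | true = good-denom F X eq ∷ []
    ... | false = []

  LK : List ℕ → ℕ → ℕ → ℤ
  LK nu e n = Σ (T (length nu)) λ k → δ (e ℕ.+ sum k) n * W 0 k nu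

  liₖ-sem : ∀ nu e n → All (0 <_) nu → ⟦ liₖ nu p ⟧⁺ e n ≈ LK nu e n
  liₖ-sem nu e n pos = ≈-trans (li-sem [] [] nu e n pos)
    (≈-trans (≡⇒≈ (trans (ℤP.+-identityʳ _) (ℤP.+-identityʳ _)))
      (Σ-cong (T (length nu)) (λ k → ≡⇒≈ (cong (δ (e ℕ.+ sum k) n *_)
        (trans (ℤP.*-identityˡ (+ 1 * W 0 k nu)) (ℤP.*-identityˡ (W 0 k nu)))))))

  inBlock : ℕ → ℕ → Bool
  inBlock i s = does ((i ∸ 1) ℕ.* p ℕ.<? s) ∧ does (s ℕ.<? i ℕ.* p)

  χ : Bool → ℤ
  χ b = if b then + 1 else + 0

  private
    ζterms : ℕ → List ℕ → List Frac
    ζterms i k = concatMap (λ l → if primeToAll p (partialSums l) ∧ inBlock i (sum l)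
                                   then [ inv (denom (partialSums l) k) ] else []) (T (length k))

    val-sumF : ∀ xs → All Good xs → val (sumF xs) ≈ Σ xs val × Good (sumF xs)
    val-sumF [] [] = ≈-refl , p∤1
    val-sumF (x ∷ xs) (g ∷ gs) with val-sumF xs gs
    ... | e , g' = ≈-trans (val-+ x (sumF xs) g g') (+-cong (≈-refl {val x}) e) , good-+ {x} {sumF xs} g g'

    good-ζterms : ∀ i k → All Good (ζterms i k)
    good-ζterms i k = collect (T (length k))
      where
      one : ∀ l → All Good (if primeToAll p (partialSums l) ∧ inBlock i (sum l)
                             then [ inv (denom (partialSums l) k) ] else [])
      one l with primeToAll p (partialSums l) in eq
      ... | false = []
      ... | true with inBlock i (sum l)
      ...   | true = good-denom (partialSums l) k eq ∷ []
      ...   | false = []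
      collect : ∀ ts → All Good (concatMap (λ l → if primeToAll p (partialSums l) ∧ inBlock i (sum l)
                                              then [ inv (denom (partialSums l) k) ] else []) ts)
      collect [] = []
      collect (t ∷ ts) = AllP.++⁺ (one t) (collect ts)

  good-ζ : ∀ i k → Good (ζA i k p)
  good-ζ i k = proj₂ (val-sumF _ (good-ζterms i k))

  ζ-sem : ∀ i k → All (0 <_) k → val (ζA i k p) ≈ Σ (T (length k)) (λ t → χ (inBlock i (sum t)) * W 0 t k)
  ζ-sem i k pos = ≈-trans (proj₁ (val-sumF _ (good-ζterms i k)))
      (≈-trans (≡⇒≈ (Σ-concatMap _ (T (length k)) val)) (ΣT-cong (length k) (λ t lt _ → one t lt)))
    where
    one : ∀ t → length t ≡ length k → Σ (if primeToAll p (partialSums t) ∧ inBlock i (sum t)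
               then [ inv (denom (partialSums t) k) ] else []) val ≈ χ (inBlock i (sum t)) * W 0 t k
    one t lt with primeToAll p (partialSums t) in eq
    ... | false = ≡⇒≈ (sym (trans (cong (χ (inBlock i (sum t)) *_)
                    (trans (cong (λ z → Wf z k) (sym (partialSums≡PS t)))
                           (Wf-excluded (partialSums t) k eq (trans (length-partialSums t) lt) pos)))
                    (ℤP.*-zeroʳ (χ (inBlock i (sum t))))))
    ... | true with inBlock i (sum t)
    ...   | false = ≡⇒≈ (sym (ℤP.*-zeroˡ (W 0 t k)))
    ...   | true = ≈-trans (≡⇒≈ (ℤP.+-identityʳ _)) (≈-trans (val-inv (denom (partialSums t) k))
                     (≈-trans (recip-denom (partialSums t) k)
                       (≡⇒≈ (trans (cong (λ z → Wf z k) (partialSums≡PS t)) (sym (ℤP.*-identityˡ (W 0 t k)))))))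

  goodP-ζsum : ∀ r κ → GoodP (ζsum r κ p)
  goodP-ζsum r κ = AllP.map⁺ (universal (λ i → good-ζ i κ) (oneTo r))

  ζsum⊛-sem : ∀ r κ Q n → ⟦ ζsum r κ p ⊛ Q ⟧ n ≈ Σ (oneTo r) (λ i → val (ζA i κ p) * ⟦ Q ⟧⁺ (p ℕ.* i) n)
  ζsum⊛-sem r κ Q n = ≈-trans (⟦⊛⟧ (ζsum r κ p) Q n) (≡⇒≈ (Σ-map _ (oneTo r) _))

  -- If u v ≡ w (u + v) — as for the reciprocals u, v, w of
  -- X, Y, X + Y — then u^(a+1) v^(b+1) is the sum of two pfSums.
  geometric : ℤ → ℤ → ℕ → ℤ
  geometric u w a = Σ (upTo (suc a)) (λ τ → u ^ (suc a ∸ τ) * w ^ suc τ)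

  geometric-suc : ∀ u w a → geometric u w (suc a) ≈ u * geometric u w a + u * w ^ suc (suc a)
  geometric-suc u w a = ≈-trans (≡⇒≈ (Σ-upTo-suc (suc a) (λ τ → u ^ (suc (suc a) ∸ τ) * w ^ suc τ)))
     (+-cong (≈-trans (Σ-cong∈ (upTo (suc a)) (λ τ τ∈ → ≡⇒≈ (factor-u τ (∈-upTo⁻ τ∈))))
                      (≡⇒≈ (Σ-* (upTo (suc a)) u (λ τ → u ^ (suc a ∸ τ) * w ^ suc τ))))
             (≡⇒≈ (trans (cong (λ z → u ^ z * w ^ suc (suc a)) (ℕP.m+n∸n≡m 1 a))
                         (cong (_* w ^ suc (suc a)) (ℤP.*-identityʳ u)))))
    where
    factor-u : ∀ τ → τ < suc a → u ^ (suc (suc a) ∸ τ) * w ^ suc τ ≡ u * (u ^ (suc a ∸ τ) * w ^ suc τ)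
    factor-u τ τ<a = trans (cong (λ z → u ^ z * w ^ suc τ) (ℕP.+-∸-assoc 1 (ℕP.<⇒≤ τ<a))) (ℤP.*-assoc u _ _)

  partial-fractions-b0 : ∀ {u v w} → u * v ≈ w * (u + v) → ∀ a → u ^ suc a * v ≈ v * w ^ suc a + geometric u w a
  partial-fractions-b0 {u} {v} {w} H zero = ≈-trans (≡⇒≈ (drop-one u v)) (≈-trans H (≡⇒≈ (expand u v w)))
    where
    drop-one : ∀ u v → u * + 1 * v ≡ u * v
    drop-one = solve-∀
    expand : ∀ u v q → q * (u + v) ≡ v * (q * + 1) + (u * + 1 * (q * + 1) + + 0)
    expand = solve-∀
  partial-fractions-b0 {u} {v} {w} H (suc a) = ≈begin
      u ^ suc (suc a) * v                        ≡⟨ ℤP.*-assoc u (u ^ suc a) v ⟩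
      u * (u ^ suc a * v)                        ≈⟨ *-cong (≈-refl {u}) (partial-fractions-b0 {u} {v} {w} H a) ⟩
      u * (v * w ^ suc a + geometric u w a)      ≡⟨ spread u v (w ^ suc a) (geometric u w a) ⟩
      w ^ suc a * (u * v) + u * geometric u w a  ≈⟨ +-cong (*-cong (≈-refl {w ^ suc a}) H) (≈-refl {u * geometric u w a}) ⟩
      w ^ suc a * (w * (u + v)) + u * geometric u w a
                                                 ≡⟨ regroup u v w (w ^ suc a) (geometric u w a) ⟩
      v * w ^ suc (suc a) + (u * geometric u w a + u * w ^ suc (suc a))
                                                 ≈⟨ +-cong (≈-refl {v * w ^ suc (suc a)}) (≈-sym (geometric-suc u w a)) ⟩
      v * w ^ suc (suc a) + geometric u w (suc a) ≈∎
    where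
    open ≈-Reasoning
    spread : ∀ u v W B → u * (v * W + B) ≡ W * (u * v) + u * B
    spread = solve-∀
    regroup : ∀ u v q W B → W * (q * (u + v)) + u * B ≡ v * (q * W) + (u * B + u * (q * W))
    regroup = solve-∀

  partial-fractions : ∀ {u v w} → u * v ≈ w * (u + v) → ∀ a b →
    u ^ suc a * v ^ suc b ≈ pfSum v w (suc a) (suc b) + pfSum u w (suc b) (suc a)
  partial-fractions {u} {v} {w} H a zero =
    ≈-trans (≡⇒≈ (cong (u ^ suc a *_) (ℤP.*-identityʳ v)))
      (≈-trans (partial-fractions-b0 {u} {v} {w} H a) (≡⇒≈ (sym (cong₂ _+_ (pfSum-b1 v w a) (pfSum-a1 u w a)))))
  partial-fractions {u} {v} {w} H zero (suc b) =
    ≈-trans (≡⇒≈ (swap u (v ^ suc (suc b))))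
      (≈-trans (partial-fractions-b0 {v} {u} {w} H' (suc b))
        (≡⇒≈ (trans (ℤP.+-comm (u * w ^ suc (suc b)) (geometric v w (suc b)))
                    (sym (cong₂ _+_ (pfSum-a1 v w (suc b)) (pfSum-b1 u w (suc b)))))))
    where
    swap : ∀ u V → u * + 1 * V ≡ V * u
    swap = solve-∀
    H' : v * u ≈ w * (v + u)
    H' = ≈-trans (≡⇒≈ (ℤP.*-comm v u)) (≈-trans H (≡⇒≈ (cong (w *_) (ℤP.+-comm u v))))
  partial-fractions {u} {v} {w} H (suc a) (suc b) = ≈begin
      u ^ suc (suc a) * v ^ suc (suc b)
        ≡⟨ split u v (u ^ suc a) (v ^ suc b) ⟩
      (u * v) * (u ^ suc a * v ^ suc b)
        ≈⟨ *-cong H (≈-refl {u ^ suc a * v ^ suc b}) ⟩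
      w * (u + v) * (u ^ suc a * v ^ suc b)
        ≡⟨ spread u v w (u ^ suc a) (v ^ suc b) ⟩
      w * (u ^ suc (suc a) * v ^ suc b + u ^ suc a * v ^ suc (suc b))
        ≈⟨ *-cong (≈-refl {w}) (+-cong (partial-fractions {u} {v} {w} H (suc a) b) (partial-fractions {u} {v} {w} H a (suc b))) ⟩
      w * ((A₁ + B₁) + (A₂ + B₂))
        ≡⟨ regroup w A₁ B₁ A₂ B₂ ⟩
      w * (A₁ + A₂) + w * (B₂ + B₁)
        ≡⟨ cong₂ _+_ (pfSum-pascal v w a b) (pfSum-pascal u w b a) ⟩
      pfSum v w (suc (suc a)) (suc (suc b)) + pfSum u w (suc (suc b)) (suc (suc a)) ≈∎
    where
    open ≈-Reasoning
    A₁ = pfSum v w (suc (suc a)) (suc b)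
    B₁ = pfSum u w (suc b) (suc (suc a))
    A₂ = pfSum v w (suc a) (suc (suc b))
    B₂ = pfSum u w (suc (suc b)) (suc a)
    split : ∀ u v U V → u * U * (v * V) ≡ (u * v) * (U * V)
    split = solve-∀
    spread : ∀ u v q U V → q * (u + v) * (U * V) ≡ q * (u * U * V + U * (v * V))
    spread = solve-∀
    regroup : ∀ q A₁ B₁ A₂ B₂ → q * ((A₁ + B₁) + (A₂ + B₂)) ≡ q * (A₁ + A₂) + q * (B₂ + B₁)
    regroup = solve-∀

  -- Degenerate pfSums: x = 0 kills every term, and for w ≡ x all terms have
  -- the same power of x, so the hockey-stick identity sums the coefficients.
  pfSum-x0 : ∀ w a b → pfSum (+ 0) w a b ≈ + 0
  pfSum-x0 w a b = Σ-zero (upTo b) (λ τ τ∈ → ≡⇒≈ (trans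
      (cong (λ z → + ((a ∸ 1 ℕ.+ τ) C τ) * (z * w ^ (a ℕ.+ τ))) (zero-power (b ∸ τ) (ℕP.m<n⇒0<n∸m (∈-upTo⁻ τ∈))))
      (trans (cong (+ ((a ∸ 1 ℕ.+ τ) C τ) *_) (ℤP.*-zeroˡ (w ^ (a ℕ.+ τ)))) (ℤP.*-zeroʳ (+ ((a ∸ 1 ℕ.+ τ) C τ))))))
    where
    zero-power : ∀ k → 0 < k → (+ 0) ^ k ≡ + 0
    zero-power (suc k) _ = refl

  pfSum-collapse : ∀ x w a b → w ≈ x → pfSum x w (suc a) (suc b) ≈ + ((suc a ℕ.+ b) C b) * x ^ (suc a ℕ.+ suc b)
  pfSum-collapse x w a b h = ≈begin
      pfSum x w (suc a) (suc b)
        ≈⟨ Σ-cong∈ (upTo (suc b)) (λ τ τ∈ → same-power τ (∈-upTo⁻ τ∈)) ⟩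
      Σ (upTo (suc b)) (λ τ → + ((a ℕ.+ τ) C τ) * x ^ (suc a ℕ.+ suc b))
        ≡⟨ Σ-*ʳ (upTo (suc b)) (x ^ (suc a ℕ.+ suc b)) (λ τ → + ((a ℕ.+ τ) C τ)) ⟩
      Σ (upTo (suc b)) (λ τ → + ((a ℕ.+ τ) C τ)) * x ^ (suc a ℕ.+ suc b)
        ≡⟨ cong (_* x ^ (suc a ℕ.+ suc b)) (hockey-stick a b) ⟩
      + ((suc a ℕ.+ b) C b) * x ^ (suc a ℕ.+ suc b) ≈∎
    where
    open ≈-Reasoning
    same-power : ∀ τ → τ < suc b → + ((a ℕ.+ τ) C τ) * (x ^ (suc b ∸ τ) * w ^ (suc a ℕ.+ τ))
                                   ≈ + ((a ℕ.+ τ) C τ) * x ^ (suc a ℕ.+ suc b)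
    same-power τ τ<b = *-cong (≈-refl {+ ((a ℕ.+ τ) C τ)})
      (≈-trans (*-cong (≈-refl {x ^ (suc b ∸ τ)}) (^-cong (suc a ℕ.+ τ) h))
        (≡⇒≈ (trans (sym (ℤP.^-distribˡ-+-* x (suc b ∸ τ) (suc a ℕ.+ τ))) (cong (x ^_) exponents))))
      where
      exponents : suc b ∸ τ ℕ.+ (suc a ℕ.+ τ) ≡ suc a ℕ.+ suc b
      exponents = trans (ℕP.+-comm (suc b ∸ τ) (suc a ℕ.+ τ))
        (trans (ℕP.+-assoc (suc a) τ (suc b ∸ τ)) (cong (suc a ℕ.+_) (ℕP.m+[n∸m]≡n (ℕP.<⇒≤ τ<b))))

  χp : ℕ → ℤ
  χp n = χ (does (p ℕD.∣? n))

  χp-yes : ∀ {n} → p ℕD.∣ n → χp n ≡ + 1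
  χp-yes {n} h with p ℕD.∣? n
  ... | yes _ = refl
  ... | no ¬h = ⊥-elim (¬h h)

  χp-no : ∀ {n} → ¬ (p ℕD.∣ n) → χp n ≡ + 0
  χp-no {n} h with p ℕD.∣? n
  ... | yes y = ⊥-elim (h y)
  ... | no _ = refl

  module Pointwise (a b : ℕ) where

    leading pfμ pfλ boundaryX boundaryY rhs : ℕ → ℕ → ℤ
    leading X Y = recip X ^ suc a * recip Y ^ suc b
    pfμ X Y = pfSum (recip Y) (recip (X ℕ.+ Y)) (suc a) (suc b)
    pfλ X Y = pfSum (recip X) (recip (X ℕ.+ Y)) (suc b) (suc a)
    boundaryX X Y = + ((suc a ℕ.+ suc b ∸ 1) C suc a) * recip Y ^ (suc a ℕ.+ suc b)
    boundaryY X Y = + ((suc a ℕ.+ suc b ∸ 1) C suc b) * recip X ^ (suc a ℕ.+ suc b)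
    rhs X Y = pfμ X Y + pfλ X Y + χp (X ℕ.+ Y) * leading X Y - χp X * boundaryX X Y - χp Y * boundaryY X Y

    private
      rhs-cong : ∀ X Y {A B c₃ c₄ c₅ K₄ K₅} → pfμ X Y ≈ A → pfλ X Y ≈ B →
                 χp (X ℕ.+ Y) ≡ c₃ → χp X ≡ c₄ → χp Y ≡ c₅ → boundaryX X Y ≈ K₄ → boundaryY X Y ≈ K₅ →
                 rhs X Y ≈ A + B + c₃ * leading X Y - c₄ * K₄ - c₅ * K₅
      rhs-cong X Y hA hB e₃ e₄ e₅ h₄ h₅ =
        +-cong (+-cong (+-cong (+-cong hA hB) (*-cong (≡⇒≈ e₃) (≈-refl {leading X Y})))
                       (neg-cong (*-cong (≡⇒≈ e₄) h₄))) (neg-cong (*-cong (≡⇒≈ e₅) h₅))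

      -- when p ∣ X + Y its reciprocal is 0, and both pfSums vanish
      pfμ-p∣ : ∀ {X Y} → p ℕD.∣ (X ℕ.+ Y) → pfμ X Y ≈ + 0
      pfμ-p∣ {X} {Y} h = ≡⇒≈ (trans (cong (λ z → pfSum (recip Y) z (suc a) (suc b)) (recip-zero h))
                                     (pfSum-w0 (recip Y) a (suc b)))

      pfλ-p∣ : ∀ {X Y} → p ℕD.∣ (X ℕ.+ Y) → pfλ X Y ≈ + 0
      pfλ-p∣ {X} {Y} h = ≡⇒≈ (trans (cong (λ z → pfSum (recip X) z (suc b) (suc a)) (recip-zero h))
                                     (pfSum-w0 (recip X) b (suc a)))

    pointwise-generic : ∀ {X Y} → ¬ (p ℕD.∣ X) → ¬ (p ℕD.∣ Y) → ¬ (p ℕD.∣ (X ℕ.+ Y)) → leading X Y ≈ rhs X Y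
    pointwise-generic {X} {Y} hX hY hZ =
      ≈-trans (partial-fractions {u} {v} {w} reciprocals a b)
        (≈-trans (≡⇒≈ (pad (pfμ X Y) (pfλ X Y) (leading X Y) (boundaryX X Y) (boundaryY X Y)))
          (≈-sym (rhs-cong X Y ≈-refl ≈-refl (χp-no hZ) (χp-no hX) (χp-no hY) ≈-refl ≈-refl)))
      where
      open ≈-Reasoning
      u = recip X
      v = recip Y
      w = recip (X ℕ.+ Y)
      pad : ∀ A B L K₄ K₅ → A + B ≡ A + B + + 0 * L - + 0 * K₄ - + 0 * K₅
      pad = solve-∀
      pull-out : ∀ u v w Z → Z * w * (u * v) ≡ w * (Z * u * v)
      pull-out = solve-∀
      spread : ∀ u v w X Y → w * ((X + Y) * u * v) ≡ w * ((X * u) * v + u * (Y * v))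
      spread = solve-∀
      tidy : ∀ u v w → w * (+ 1 * v + u * + 1) ≡ w * (u + v)
      tidy = solve-∀
      -- xy = z(x + y), i.e. 1/(XY) = 1/((X+Y)Y) + 1/((X+Y)X)
      reciprocals : u * v ≈ w * (u + v)
      reciprocals = ≈begin
        u * v                                 ≡⟨ ℤP.*-identityˡ (u * v) ⟨
        + 1 * (u * v)                         ≈⟨ *-cong (≈-sym (recip-inv hZ)) (≈-refl {u * v}) ⟩
        + (X ℕ.+ Y) * w * (u * v)             ≡⟨ pull-out u v w (+ (X ℕ.+ Y)) ⟩
        w * (+ (X ℕ.+ Y) * u * v)             ≡⟨ cong (λ z → w * (z * u * v)) (ℤP.pos-+ X Y) ⟩
        w * ((+ X + + Y) * u * v)             ≡⟨ spread u v w (+ X) (+ Y) ⟩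
        w * ((+ X * u) * v + u * (+ Y * v))   ≈⟨ *-cong (≈-refl {w}) (+-cong (*-cong (recip-inv hX) (≈-refl {v}))
                                                                             (*-cong (≈-refl {u}) (recip-inv hY))) ⟩
        w * (+ 1 * v + u * + 1)               ≡⟨ tidy u v w ⟩
        w * (u + v) ≈∎

    -- p ∣ X + Y only: both pfSums vanish and the third term takes over
    pointwise-sum : ∀ {X Y} → ¬ (p ℕD.∣ X) → ¬ (p ℕD.∣ Y) → p ℕD.∣ (X ℕ.+ Y) → leading X Y ≈ rhs X Y
    pointwise-sum {X} {Y} hX hY hZ =
      ≈-trans (≡⇒≈ (pad (leading X Y) (boundaryX X Y) (boundaryY X Y)))
        (≈-sym (rhs-cong X Y (pfμ-p∣ {X} {Y} hZ) (pfλ-p∣ {X} {Y} hZ) (χp-yes hZ) (χp-no hX) (χp-no hY) ≈-refl ≈-refl))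
      where
      pad : ∀ L K₄ K₅ → L ≡ + 0 + + 0 + + 1 * L - + 0 * K₄ - + 0 * K₅
      pad = solve-∀

    -- p divides X, Y and X + Y: everything but the third term vanishes
    pointwise-all : ∀ {X Y} → p ℕD.∣ X → p ℕD.∣ Y → p ℕD.∣ (X ℕ.+ Y) → leading X Y ≈ rhs X Y
    pointwise-all {X} {Y} hX hY hZ =
      ≈-trans (≡⇒≈ (pad (leading X Y)))
        (≈-sym (rhs-cong X Y (pfμ-p∣ {X} {Y} hZ) (pfλ-p∣ {X} {Y} hZ) (χp-yes hZ) (χp-yes hX) (χp-yes hY)
          (≡⇒≈ (trans (cong (λ z → + ((suc a ℕ.+ suc b ∸ 1) C suc a) * z ^ (suc a ℕ.+ suc b)) (recip-zero hY))
                       (ℤP.*-zeroʳ (+ ((suc a ℕ.+ suc b ∸ 1) C suc a)))))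
          (≡⇒≈ (trans (cong (λ z → + ((suc a ℕ.+ suc b ∸ 1) C suc b) * z ^ (suc a ℕ.+ suc b)) (recip-zero hX))
                       (ℤP.*-zeroʳ (+ ((suc a ℕ.+ suc b ∸ 1) C suc b)))))))
      where
      pad : ∀ L → L ≡ + 0 + + 0 + + 1 * L - + 1 * + 0 - + 1 * + 0
      pad = solve-∀

    -- p ∣ X only: the left side is 0, and the first sum collapses onto the fourth term
    pointwise-X : ∀ {X Y} → p ℕD.∣ X → ¬ (p ℕD.∣ Y) → ¬ (p ℕD.∣ (X ℕ.+ Y)) → leading X Y ≈ rhs X Y
    pointwise-X {X} {Y} hX hY hZ =
      ≈-trans (≡⇒≈ (cong (λ z → z ^ suc a * recip Y ^ suc b) (recip-zero hX)))
        (≈-trans (≡⇒≈ (pad (boundaryX X Y) (leading X Y) (boundaryY X Y)))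
          (≈-sym (rhs-cong X Y
            (≈-trans (pfSum-collapse (recip Y) (recip (X ℕ.+ Y)) a b (recip-cong (+-p∣ˡ {X} {Y} hX)))
               (≡⇒≈ (cong (λ c → + c * recip Y ^ (suc a ℕ.+ suc b)) (binom-symm a b))))
            (≈-trans (≡⇒≈ (cong (λ z → pfSum z (recip (X ℕ.+ Y)) (suc b) (suc a)) (recip-zero hX)))
                     (pfSum-x0 (recip (X ℕ.+ Y)) (suc b) (suc a)))
            (χp-no hZ) (χp-yes hX) (χp-no hY) ≈-refl ≈-refl)))
      where
      pad : ∀ K₄ L K₅ → + 0 ≡ K₄ + + 0 + + 0 * L - + 1 * K₄ - + 0 * K₅
      pad = solve-∀

    pointwise-Y : ∀ {X Y} → ¬ (p ℕD.∣ X) → p ℕD.∣ Y → ¬ (p ℕD.∣ (X ℕ.+ Y)) → leading X Y ≈ rhs X Y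
    pointwise-Y {X} {Y} hX hY hZ =
      ≈-trans (≡⇒≈ (trans (cong (λ z → recip X ^ suc a * z ^ suc b) (recip-zero hY)) (ℤP.*-zeroʳ (recip X ^ suc a))))
        (≈-trans (≡⇒≈ (pad (boundaryX X Y) (leading X Y) (boundaryY X Y)))
          (≈-sym (rhs-cong X Y
            (≈-trans (≡⇒≈ (cong (λ z → pfSum z (recip (X ℕ.+ Y)) (suc a) (suc b)) (recip-zero hY)))
                     (pfSum-x0 (recip (X ℕ.+ Y)) (suc a) (suc b)))
            (≈-trans (pfSum-collapse (recip X) (recip (X ℕ.+ Y)) b a (recip-cong (+-p∣ʳ {X} {Y} hY)))
               (≡⇒≈ (cong₂ (λ c e → + c * recip X ^ e)
                      (trans (binom-symm b a) (cong (λ z → (z ∸ 1) C suc b) (ℕP.+-comm (suc b) (suc a))))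
                      (ℕP.+-comm (suc b) (suc a)))))
            (χp-no hZ) (χp-no hX) (χp-yes hY) ≈-refl ≈-refl)))
      where
      pad : ∀ K₄ L K₅ → + 0 ≡ + 0 + K₅ + + 0 * L - + 0 * K₄ - + 1 * K₅
      pad = solve-∀

    pointwise : ∀ X Y → leading X Y ≈ rhs X Y
    pointwise X Y = by-cases (p ℕD.∣? X) (p ℕD.∣? Y) (p ℕD.∣? (X ℕ.+ Y))
      where
      by-cases : Dec (p ℕD.∣ X) → Dec (p ℕD.∣ Y) → Dec (p ℕD.∣ (X ℕ.+ Y)) → leading X Y ≈ rhs X Y
      by-cases (no hX) (no hY) (no hZ) = pointwise-generic hX hY hZ
      by-cases (no hX) (no hY) (yes hZ) = pointwise-sum hX hY hZ
      by-cases (yes hX) (yes hY) (yes hZ) = pointwise-all hX hY hZ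
      by-cases (yes hX) (no hY) (no hZ) = pointwise-X hX hY hZ
      by-cases (no hX) (yes hY) (no hZ) = pointwise-Y hX hY hZ
      by-cases (yes hX) (yes hY) (no hZ) = ⊥-elim (hZ (ℕD.∣m∣n⇒∣m+n hX hY))
      by-cases (yes hX) (no hY) (yes hZ) = ⊥-elim (hY (ℕD.∣m+n∣m⇒∣n hZ hX))
      by-cases (no hX) (yes hY) (yes hZ) = ⊥-elim (hX (ℕD.∣m+n∣m⇒∣n (subst (p ℕD.∣_) (ℕP.+-comm X Y) hZ) hY))

  -- Writing A = q p + ρ, among A+1, …, A+p-1 there is a
  -- multiple of p exactly when ρ ≠ 0, namely (q+1) p, and then A lies in the
  -- open block ((j-1)p, jp) for j = q + 1; if ρ = 0 neither happens.
  private instance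
    p≢0 : ℕ.NonZero p
    p≢0 = ℕ.>-nonZero (ℕP.<-trans (s≤s z≤n) p>1)

  division : ∀ A → A ≡ A % p ℕ.+ (A / p) ℕ.* p
  division A = m≡m%n+[m/n]*n A p

  quotient≤ : ∀ A → (A / p) ℕ.* p ≤ A
  quotient≤ A = subst ((A / p) ℕ.* p ≤_) (sym (division A)) (ℕP.m≤n+m ((A / p) ℕ.* p) (A % p))

  <suc-quotient : ∀ A → A < suc (A / p) ℕ.* p
  <suc-quotient A = subst (_< suc (A / p) ℕ.* p) (sym (division A)) (ℕP.+-monoˡ-< ((A / p) ℕ.* p) (m%n<n A p))

  inBlock⇒quotient : ∀ j A → inBlock (suc j) A ≡ true → j ≡ A / p × 0 < A % p
  inBlock⇒quotient j A h = from-decisions (j ℕ.* p ℕ.<? A) (A ℕ.<? suc j ℕ.* p) h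
    where
    from-decisions : (d₁ : Dec (j ℕ.* p < A)) (d₂ : Dec (A < suc j ℕ.* p)) → (does d₁ ∧ does d₂) ≡ true →
                     j ≡ A / p × 0 < A % p
    from-decisions (yes lo) (yes hi) _ = j≡q , 0<ρ
      where
      j≡q : j ≡ A / p
      j≡q = ℕP.≤-antisym (ℕP.≤-pred (ℕP.*-cancelʳ-< p j (suc (A / p)) (ℕP.<-trans lo (<suc-quotient A))))
                         (ℕP.≤-pred (ℕP.*-cancelʳ-< p (A / p) (suc j) (ℕP.≤-<-trans (quotient≤ A) hi)))
      0<ρ : 0 < A % p
      0<ρ = ℕP.n≢0⇒n>0 (λ ρ≡0 → ℕP.<-irrefl refl (subst (j ℕ.* p <_)
              (trans (division A) (trans (cong (ℕ._+ (A / p) ℕ.* p) ρ≡0) (cong (ℕ._* p) (sym j≡q)))) lo))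
    from-decisions (yes _) (no _) ()
    from-decisions (no _) _ ()

  quotient⇒inBlock : ∀ A → 0 < A % p → inBlock (suc (A / p)) A ≡ true
  quotient⇒inBlock A 0<ρ = cong₂ _∧_ (dec-true ((A / p) ℕ.* p ℕ.<? A) lo) (dec-true (A ℕ.<? suc (A / p) ℕ.* p) (<suc-quotient A))
    where
    lo : (A / p) ℕ.* p < A
    lo = subst ((A / p) ℕ.* p <_) (sym (division A)) (ℕP.m<n+m ((A / p) ℕ.* p) 0<ρ)

  unique-shift≤ : ∀ A x y → x ≤ y → y < p → p ℕD.∣ (A ℕ.+ x) → p ℕD.∣ (A ℕ.+ y) → x ≡ y
  unique-shift≤ A x y x≤y y<p hx hy = ℕP.≤-antisym x≤y (ℕP.m∸n≡0⇒m≤n (small (ℕP.≤-<-trans (ℕP.m∸n≤m y x) y<p) d))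
    where
    d : p ℕD.∣ (y ∸ x)
    d = ℕD.∣m+n∣m⇒∣n (subst (p ℕD.∣_) (trans (cong (A ℕ.+_) (sym (ℕP.m+[n∸m]≡n x≤y)))
                                              (sym (ℕP.+-assoc A x (y ∸ x)))) hy) hx
    small : ∀ {d} → d < p → p ℕD.∣ d → d ≡ 0
    small {zero} _ _ = refl
    small {suc d} d<p h = ⊥-elim (ℕP.<-irrefl refl (ℕP.<-≤-trans d<p (ℕD.∣⇒≤ h)))

  unique-shift : ∀ A x y → x < p → y < p → p ℕD.∣ (A ℕ.+ x) → p ℕD.∣ (A ℕ.+ y) → x ≡ y
  unique-shift A x y x<p y<p hx hy with ℕP.≤-total x y
  ... | inj₁ x≤y = unique-shift≤ A x y x≤y y<p hx hy
  ... | inj₂ y≤x = sym (unique-shift≤ A y x y≤x x<p hy hx)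

  vanishing : ∀ {c} (G : ℤ) → c ≡ + 0 → c * G ≈ + 0
  vanishing G refl = ≡⇒≈ (ℤP.*-zeroˡ G)

  -- if p ∤ A, the only multiple of p among A+1, …, A+p-1 is (q+1) p
  residue-sum : ∀ A (G : ℕ → ℤ) → ¬ (p ℕD.∣ A) → Σ R (λ x → χp (A ℕ.+ x) * G (A ℕ.+ x)) ≈ G (p ℕ.* suc (A / p))
  residue-sum A G p∤A =
    ≈-trans (≡⇒≈ (Σ-map suc (upTo (p ∸ 1)) f))
      (≈-trans (Σ-delta (p ∸ 1) i₀ (f ∘ suc) i₀<p-1 (λ x x<p x≢ → vanishing (G (A ℕ.+ suc x))
                  (χp-no λ h → x≢ (ℕP.suc-injective (unique-shift A (suc x) (suc i₀) (below x x<p) (below i₀ i₀<p-1) h p∣A+i₀)))))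
      (≡⇒≈ (trans (cong (_* G (A ℕ.+ suc i₀)) (χp-yes p∣A+i₀)) (trans (ℤP.*-identityˡ _) (cong G A+i₀≡)))))
    where
    q = A / p
    ρ = A % p
    f : ℕ → ℤ
    f x = χp (A ℕ.+ x) * G (A ℕ.+ x)
    0<ρ : 0 < ρ
    0<ρ = ℕP.n≢0⇒n>0 (λ e → p∤A (ℕD.m%n≡0⇒n∣m A p e))
    i₀ = p ∸ suc ρ
    i₀+ρ : suc i₀ ℕ.+ ρ ≡ p
    i₀+ρ = trans (sym (ℕP.+-suc i₀ ρ)) (ℕP.m∸n+n≡m (m%n<n A p))
    A+i₀≡ : A ℕ.+ suc i₀ ≡ p ℕ.* suc q
    A+i₀≡ = begin
      A ℕ.+ suc i₀               ≡⟨ cong (ℕ._+ suc i₀) (division A) ⟩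
      ρ ℕ.+ q ℕ.* p ℕ.+ suc i₀   ≡⟨ rotate ρ (q ℕ.* p) (suc i₀) ⟩
      (suc i₀ ℕ.+ ρ) ℕ.+ q ℕ.* p ≡⟨ cong (ℕ._+ q ℕ.* p) i₀+ρ ⟩
      p ℕ.+ q ℕ.* p              ≡⟨ ℕP.*-comm (suc q) p ⟩
      p ℕ.* suc q ∎
      where
      open ≡-Reasoning
      rotate : ∀ a b c → a ℕ.+ b ℕ.+ c ≡ (c ℕ.+ a) ℕ.+ b
      rotate = ℕSolver.solve-∀
    p∣A+i₀ : p ℕD.∣ (A ℕ.+ suc i₀)
    p∣A+i₀ = subst (p ℕD.∣_) (sym A+i₀≡) (ℕD.m∣m*n (suc q))
    i₀<p-1 : i₀ < p ∸ 1
    i₀<p-1 = ℕP.∸-monoˡ-≤ 1 (subst (suc (suc i₀) ≤_) i₀+ρ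
               (subst (_≤ suc i₀ ℕ.+ ρ) (ℕP.+-comm (suc i₀) 1) (ℕP.+-monoʳ-≤ (suc i₀) 0<ρ)))
    below : ∀ i → i < p ∸ 1 → suc i < p
    below i h = ℕP.≤-trans (s≤s h) (ℕP.≤-reflexive (trans (ℕP.+-comm 1 (p ∸ 1)) p∸1+1≡p))

  -- if p ∤ A ≤ r(p-1), then A lies in exactly one of the first r blocks, that of index q + 1
  block-sum : ∀ r A (G : ℕ → ℤ) → ¬ (p ℕD.∣ A) → A ≤ r ℕ.* (p ∸ 1) →
              Σ (oneTo r) (λ i → χ (inBlock i A) * G (p ℕ.* i)) ≈ G (p ℕ.* suc (A / p))
  block-sum r A G p∤A bound =
    ≈-trans (≡⇒≈ (Σ-map suc (upTo r) g))
      (≈-trans (Σ-delta r (A / p) (g ∘ suc) q<r (λ j _ j≢q → vanishing (G (p ℕ.* suc j)) (outside j j≢q)))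
        (≡⇒≈ (trans (cong (λ b → χ b * G (p ℕ.* suc (A / p))) (quotient⇒inBlock A 0<ρ)) (ℤP.*-identityˡ _))))
    where
    g : ℕ → ℤ
    g i = χ (inBlock i A) * G (p ℕ.* i)
    0<ρ : 0 < A % p
    0<ρ = ℕP.n≢0⇒n>0 (λ e → p∤A (ℕD.m%n≡0⇒n∣m A p e))
    A<rp : ∀ r → A ≤ r ℕ.* (p ∸ 1) → A < r ℕ.* p
    A<rp zero bound = ⊥-elim (p∤A (subst (p ℕD.∣_) (sym (ℕP.n≤0⇒n≡0 bound)) (ℕD.divides 0 refl)))
    A<rp (suc r') bound = ℕP.≤-<-trans bound (ℕP.*-monoʳ-< (suc r') (ℕP.∸-monoʳ-< {p} {1} {0} (s≤s z≤n) (ℕP.<⇒≤ p>1)))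
    q<r : A / p < r
    q<r = ℕP.*-cancelʳ-< p (A / p) r (ℕP.≤-<-trans (quotient≤ A) (A<rp r bound))
    outside : ∀ j → j ≢ A / p → χ (inBlock (suc j) A) ≡ + 0
    outside j j≢q with inBlock (suc j) A in eq
    ... | false = refl
    ... | true = ⊥-elim (j≢q (proj₁ (inBlock⇒quotient j A eq)))

  distribution : ∀ r A (G : ℕ → ℤ) → A ≤ r ℕ.* (p ∸ 1) →
    Σ R (λ x → χp (A ℕ.+ x) * G (A ℕ.+ x)) ≈ Σ (oneTo r) (λ i → χ (inBlock i A) * G (p ℕ.* i))
  distribution r A G bound with p ℕD.∣? A
  ... | no p∤A = ≈-trans (residue-sum A G p∤A) (≈-sym (block-sum r A G p∤A bound))
  ... | yes p∣A = ≈-trans (Σ-zero R (λ x x∈ → no-multiple x (range-InR x∈)))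
                    (≈-sym (≈-trans (≡⇒≈ (Σ-map suc (upTo r) _)) (Σ-zero (upTo r) (λ j _ → no-block j))))
    where
    no-multiple : ∀ x → InR x → χp (A ℕ.+ x) * G (A ℕ.+ x) ≈ + 0
    no-multiple (suc x) (_ , x<p) = vanishing (G (A ℕ.+ suc x))
      (χp-no λ h → ℕP.<-irrefl refl (ℕP.<-≤-trans x<p (ℕD.∣⇒≤ (ℕD.∣m+n∣m⇒∣n h p∣A))))
    no-block : ∀ j → χ (inBlock (suc j) A) * G (p ℕ.* suc j) ≈ + 0
    no-block j with inBlock (suc j) A in eq
    ... | false = vanishing (G (p ℕ.* suc j)) refl
    ... | true = ⊥-elim (ℕP.<-irrefl (sym (ℕD.n∣m⇒m%n≡0 A p p∣A)) (proj₂ (inBlock⇒quotient j A eq)))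

  -- If s + x + Σw ≡ -L (mod p), then every partial sum
  -- s + x + w₁ + … + w_j is ≡ -(L + w_r + … + w_{j+1}); so the weight of the
  -- partial sums of x ∷ w from s equals, up to the sign (-1)^(Σ exponents), the
  -- weight of the reversed tuple from L, the last exponent going to L itself.
  reversal : ∀ s L x w es e → length es ≡ length w → p ℕD.∣ (L ℕ.+ s ℕ.+ x ℕ.+ sum w) →
    W s (x ∷ w) (es ∷ʳ e) ≈ sgn (sum es ℕ.+ e) * recip L ^ e * W L (reverse w) (reverse es)
  reversal s L x [] [] e _ h = ≈begin
      recip (s ℕ.+ x) ^ e * + 1   ≈⟨ *-cong (^-cong e (recip-neg {s ℕ.+ x} {L} h')) (≈-refl {+ 1}) ⟩
      (- recip L) ^ e * + 1       ≡⟨ cong (_* + 1) (neg-^ e (recip L)) ⟩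
      sgn e * recip L ^ e * + 1 ≈∎
    where
    open ≈-Reasoning
    h' : p ℕD.∣ (s ℕ.+ x ℕ.+ L)
    h' = subst (p ℕD.∣_) (rearrange L s x) h
      where
      rearrange : ∀ L s x → L ℕ.+ s ℕ.+ x ℕ.+ 0 ≡ s ℕ.+ x ℕ.+ L
      rearrange = ℕSolver.solve-∀
  reversal s L x (y ∷ w) (f ∷ es) e l h = ≈begin
      recip (s ℕ.+ x) ^ f * W (s ℕ.+ x) (y ∷ w) (es ∷ʳ e)
        ≈⟨ *-cong (^-cong f (recip-neg {s ℕ.+ x} {L ℕ.+ sum w ℕ.+ y} h₁))
                  (reversal (s ℕ.+ x) L y w es e (ℕP.suc-injective l) h₂) ⟩
      (- recip (L ℕ.+ sum w ℕ.+ y)) ^ f * (sgn (sum es ℕ.+ e) * recip L ^ e * rest)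
        ≡⟨ cong (_* (sgn (sum es ℕ.+ e) * recip L ^ e * rest)) (neg-^ f _) ⟩
      (sgn f * recip (L ℕ.+ sum w ℕ.+ y) ^ f) * (sgn (sum es ℕ.+ e) * recip L ^ e * rest)
        ≡⟨ regroup (sgn f) (recip (L ℕ.+ sum w ℕ.+ y) ^ f) (sgn (sum es ℕ.+ e)) (recip L ^ e) rest ⟩
      (sgn f * sgn (sum es ℕ.+ e)) * recip L ^ e * (rest * recip (L ℕ.+ sum w ℕ.+ y) ^ f)
        ≡⟨ cong₂ (λ a b → a * recip L ^ e * b)
             (trans (sym (sgn-+ f (sum es ℕ.+ e))) (cong sgn (sym (ℕP.+-assoc f (sum es) e))))
             (trans (cong (λ z → rest * recip (L ℕ.+ z ℕ.+ y) ^ f) (sym (sum-reverse w)))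
                    (sym (W-∷ʳ L (reverse w) y (reverse es) f
                      (trans (LP.length-reverse w) (trans (sym (ℕP.suc-injective l)) (sym (LP.length-reverse es))))))) ⟩
      sgn (f ℕ.+ sum es ℕ.+ e) * recip L ^ e * W L (reverse w ∷ʳ y) (reverse es ∷ʳ f)
        ≡⟨ cong₂ (λ a b → sgn (f ℕ.+ sum es ℕ.+ e) * recip L ^ e * W L a b)
                 (sym (LP.unfold-reverse y w)) (sym (LP.unfold-reverse f es)) ⟩
      sgn (sum (f ∷ es) ℕ.+ e) * recip L ^ e * W L (reverse (y ∷ w)) (reverse (f ∷ es)) ≈∎
    where
    open ≈-Reasoning
    rest = W L (reverse w) (reverse es)
    regroup : ∀ sf cf S A B → (sf * cf) * (S * A * B) ≡ (sf * S) * A * (B * cf)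
    regroup = solve-∀
    h₁ : p ℕD.∣ (s ℕ.+ x ℕ.+ (L ℕ.+ sum w ℕ.+ y))
    h₁ = subst (p ℕD.∣_) (rearrange L s x y (sum w)) h
      where
      rearrange : ∀ L s x y W → L ℕ.+ s ℕ.+ x ℕ.+ (y ℕ.+ W) ≡ s ℕ.+ x ℕ.+ (L ℕ.+ W ℕ.+ y)
      rearrange = ℕSolver.solve-∀
    h₂ : p ℕD.∣ (L ℕ.+ (s ℕ.+ x) ℕ.+ y ℕ.+ sum w)
    h₂ = subst (p ℕD.∣_) (rearrange L s x y (sum w)) h
      where
      rearrange : ∀ L s x y W → L ℕ.+ s ℕ.+ x ℕ.+ (y ℕ.+ W) ≡ L ℕ.+ (s ℕ.+ x) ℕ.+ y ℕ.+ W
      rearrange = ℕSolver.solve-∀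

  -- Each
  -- side is read as a sum over (l, x, m, y, k) — l, m, k tuples of the lengths of
  -- ls, ms, ns and x, y residues — of a common factor Q times a function of
  -- X = Σl + x and Y = Σm + y (the 'core' of that function), so that the
  -- pointwise identity can be applied under the sum.
  module Assembly (ls : List ℕ) (a : ℕ) (ms : List ℕ) (b : ℕ) (ns : List ℕ)
                  (posl : All (0 <_) ls) (posm : All (0 <_) ms) (posn : All (0 <_) ns) where
    open Pointwise a b

    la mb α β c eL : ℕ
    la = suc a
    mb = suc b
    α = length ls
    β = length ms
    c = length ns
    eL = la ℕ.+ mb

    F5 : Set
    F5 = List ℕ → ℕ → List ℕ → ℕ → List ℕ → ℤ

    Σ5 : F5 → ℤ
    Σ5 f = Σ (T α) λ l → Σ R λ x → Σ (T β) λ m → Σ R λ y → Σ (T c) λ k → f l x m y k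

    Σ5-cong : ∀ {f g : F5} → (∀ l x m y k → length l ≡ α → InR x → length m ≡ β → InR y → length k ≡ c →
              f l x m y k ≈ g l x m y k) → Σ5 f ≈ Σ5 g
    Σ5-cong h = ΣT-cong α λ l ll _ → Σ-cong∈ R λ x x∈ → ΣT-cong β λ m lm _ → Σ-cong∈ R λ y y∈ → ΣT-cong c λ k lk _ →
       h l x m y k ll (range-InR x∈) lm (range-InR y∈) lk

    Σ5-cong≡ : ∀ {f g : F5} → (∀ l x m y k → f l x m y k ≡ g l x m y k) → Σ5 f ≡ Σ5 g
    Σ5-cong≡ h = Σ-cong≡ (T α) λ l → Σ-cong≡ R λ x → Σ-cong≡ (T β) λ m → Σ-cong≡ R λ y → Σ-cong≡ (T c) λ k → h l x m y k

    Σ5-+ : ∀ (f g : F5) → Σ5 (λ l x m y k → f l x m y k + g l x m y k) ≡ Σ5 f + Σ5 g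
    Σ5-+ f g = trans (Σ-cong≡ (T α) λ l → trans (Σ-cong≡ R λ x → trans (Σ-cong≡ (T β) λ m → trans (Σ-cong≡ R λ y →
        Σ-+ (T c) (f l x m y) (g l x m y)) (Σ-+ R _ _)) (Σ-+ (T β) _ _)) (Σ-+ R _ _)) (Σ-+ (T α) _ _)

    Σ5-neg : ∀ (f : F5) → Σ5 (λ l x m y k → - f l x m y k) ≡ - Σ5 f
    Σ5-neg f = trans (Σ-cong≡ (T α) λ l → trans (Σ-cong≡ R λ x → trans (Σ-cong≡ (T β) λ m → trans (Σ-cong≡ R λ y →
        Σ-neg (T c) (f l x m y)) (Σ-neg R _)) (Σ-neg (T β) _)) (Σ-neg R _)) (Σ-neg (T α) _)

    Σ5-* : ∀ (d : ℤ) (f : F5) → Σ5 (λ l x m y k → d * f l x m y k) ≡ d * Σ5 f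
    Σ5-* d f = trans (Σ-cong≡ (T α) λ l → trans (Σ-cong≡ R λ x → trans (Σ-cong≡ (T β) λ m → trans (Σ-cong≡ R λ y →
        Σ-* (T c) d (f l x m y)) (Σ-* R d _)) (Σ-* (T β) d _)) (Σ-* R d _)) (Σ-* (T α) d _)

    Σ5-pull : ∀ {A : Set} (U : List A) (f : A → F5) →
              Σ5 (λ l x m y k → Σ U (λ u → f u l x m y k)) ≡ Σ U (λ u → Σ5 (f u))
    Σ5-pull U f = trans (Σ-cong≡ (T α) λ l → trans (Σ-cong≡ R λ x → trans (Σ-cong≡ (T β) λ m → trans (Σ-cong≡ R λ y →
        Σ-comm (T c) U _) (Σ-comm R U _)) (Σ-comm (T β) U _)) (Σ-comm R U _)) (Σ-comm (T α) U _)

    Q : ℕ → F5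
    Q n l x m y k = δ (sum l ℕ.+ x ℕ.+ (sum m ℕ.+ y) ℕ.+ sum k) n *
                    (W 0 l ls * (W 0 m ms * W (sum l ℕ.+ x ℕ.+ (sum m ℕ.+ y)) k ns))

    Core : (ℕ → ℕ → ℤ) → ℕ → ℤ
    Core F n = Σ5 (λ l x m y k → Q n l x m y k * F (sum l ℕ.+ x) (sum m ℕ.+ y))

    LHS-core : ∀ n → ⟦ li (ls ∷ʳ la) (ms ∷ʳ mb) ns p ⟧ n ≈ Core leading n
    LHS-core n = ≈-trans (li-sem (ls ∷ʳ la) (ms ∷ʳ mb) ns 0 n
                   (AllP.++⁺ (AllP.∷ʳ⁺ posl (s≤s z≤n)) (AllP.++⁺ (AllP.∷ʳ⁺ posm (s≤s z≤n)) posn)))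
        (≈-trans (≡⇒≈ split-last) (Σ5-cong termwise))
      where
      body : List ℕ → List ℕ → List ℕ → ℤ
      body l m k = δ (sum l ℕ.+ sum m ℕ.+ sum k) n * (W 0 l (ls ∷ʳ la) * (W 0 m (ms ∷ʳ mb) * W (sum l ℕ.+ sum m) k ns))
      split-last : LIsem (ls ∷ʳ la) (ms ∷ʳ mb) ns 0 n ≡ Σ5 (λ l x m y k → body (l ∷ʳ x) (m ∷ʳ y) k)
      split-last = trans (cong₂ (λ r s → Σ (T r) (λ l → Σ (T s) (λ m → Σ (T c) (λ k → body l m k))))
                                (length-∷ʳ ls la) (length-∷ʳ ms mb))
                         (trans (ΣT-∷ʳ α _) (Σ-cong≡ (T α) λ l → Σ-cong≡ R λ x → ΣT-∷ʳ β _))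
      regroup : ∀ d Wl iX Wm iY Wk → d * ((Wl * iX) * ((Wm * iY) * Wk)) ≡ (d * (Wl * (Wm * Wk))) * (iX * iY)
      regroup = solve-∀
      termwise : ∀ l x m y k → length l ≡ α → InR x → length m ≡ β → InR y → length k ≡ c →
                 body (l ∷ʳ x) (m ∷ʳ y) k ≈ Q n l x m y k * leading (sum l ℕ.+ x) (sum m ℕ.+ y)
      termwise l x m y k ll _ lm _ _ = ≡⇒≈ (begin
          body (l ∷ʳ x) (m ∷ʳ y) k
            ≡⟨ cong₂ (λ s t → δ (s ℕ.+ t ℕ.+ sum k) n * (W 0 (l ∷ʳ x) (ls ∷ʳ la) * (W 0 (m ∷ʳ y) (ms ∷ʳ mb) * W (s ℕ.+ t) k ns)))
                 (sum-∷ʳ l x) (sum-∷ʳ m y) ⟩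
          d * (W 0 (l ∷ʳ x) (ls ∷ʳ la) * (W 0 (m ∷ʳ y) (ms ∷ʳ mb) * Wk))
            ≡⟨ cong₂ (λ A B → d * (A * (B * Wk))) (W-∷ʳ 0 l x ls la ll) (W-∷ʳ 0 m y ms mb lm) ⟩
          d * ((W 0 l ls * recip X ^ la) * ((W 0 m ms * recip Y ^ mb) * Wk))
            ≡⟨ regroup d (W 0 l ls) (recip X ^ la) (W 0 m ms) (recip Y ^ mb) Wk ⟩
          Q n l x m y k * leading X Y ∎)
        where
        open ≡-Reasoning
        X = sum l ℕ.+ x
        Y = sum m ℕ.+ y
        d = δ (X ℕ.+ Y ℕ.+ sum k) n
        Wk = W (X ℕ.+ Y) k ns

    Core-split : ∀ n → Core leading n ≈
       Core pfμ n + Core pfλ n + Core (λ X Y → χp (X ℕ.+ Y) * leading X Y) n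
         - Core (λ X Y → χp X * boundaryX X Y) n - Core (λ X Y → χp Y * boundaryY X Y) n
    Core-split n =
      ≈-trans (Σ5-cong (λ l x m y k _ _ _ _ _ → *-cong (≈-refl {Q n l x m y k}) (pointwise (sum l ℕ.+ x) (sum m ℕ.+ y))))
        (≡⇒≈ (trans (Σ5-cong≡ (λ l x m y k → distribute (Q n l x m y k) _ _ _ _ _))
          (trans (Σ5-+ _ _) (cong₂ _+_ (trans (Σ5-+ _ _) (cong₂ _+_ (trans (Σ5-+ _ _) (cong₂ _+_ (Σ5-+ _ _) refl))
                                                                    (Σ5-neg _)))
                                       (Σ5-neg _)))))
      where
      distribute : ∀ Q A B C D E → Q * (A + B + C - D - E) ≡ Q * A + Q * B + Q * C + - (Q * D) + - (Q * E)
      distribute = solve-∀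

    li-μ-sem : ∀ e₁ e₂ n → LIsem ls (ms ∷ʳ e₁) (e₂ ∷ ns) 0 n ≈
      Σ5 (λ l x m y k → Q n l x m y k * (recip (sum m ℕ.+ y) ^ e₁ * recip (sum l ℕ.+ x ℕ.+ (sum m ℕ.+ y)) ^ e₂))
    li-μ-sem e₁ e₂ n = ≈-trans (≡⇒≈ reindex) (Σ5-cong termwise)
      where
      body : List ℕ → List ℕ → List ℕ → ℤ
      body l m k = δ (sum l ℕ.+ sum m ℕ.+ sum k) n * (W 0 l ls * (W 0 m (ms ∷ʳ e₁) * W (sum l ℕ.+ sum m) k (e₂ ∷ ns)))
      -- the first entry of the ν-tuple plays the role of x
      reindex : LIsem ls (ms ∷ʳ e₁) (e₂ ∷ ns) 0 n ≡ Σ5 (λ l x m y k → body l (m ∷ʳ y) (x ∷ k))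
      reindex = trans (cong (λ s → Σ (T α) (λ l → Σ (T s) (λ m → Σ (T (suc c)) (λ k → body l m k)))) (length-∷ʳ ms e₁))
        (Σ-cong≡ (T α) λ l → trans (ΣT-∷ʳ β _) (trans (Σ-cong≡ (T β) (λ m → Σ-cong≡ R (λ y → ΣT-∷ c _)))
          (trans (Σ-cong≡ (T β) (λ m → Σ-comm R R _)) (Σ-comm (T β) R _))))
      regroup : ∀ d Wl Wm iY iZ Wk → d * (Wl * ((Wm * iY) * (iZ * Wk))) ≡ (d * (Wl * (Wm * Wk))) * (iY * iZ)
      regroup = solve-∀
      swap-last : ∀ L M x → L ℕ.+ M ℕ.+ x ≡ L ℕ.+ x ℕ.+ M
      swap-last = ℕSolver.solve-∀
      swap-middle : ∀ L M x K → L ℕ.+ M ℕ.+ (x ℕ.+ K) ≡ L ℕ.+ x ℕ.+ M ℕ.+ K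
      swap-middle = ℕSolver.solve-∀
      termwise : ∀ l x m y k → length l ≡ α → InR x → length m ≡ β → InR y → length k ≡ c →
        body l (m ∷ʳ y) (x ∷ k) ≈ Q n l x m y k * (recip (sum m ℕ.+ y) ^ e₁ * recip (sum l ℕ.+ x ℕ.+ (sum m ℕ.+ y)) ^ e₂)
      termwise l x m y k ll _ lm _ _ = ≡⇒≈ (begin
          body l (m ∷ʳ y) (x ∷ k)
            ≡⟨ cong (λ t → δ (sum l ℕ.+ t ℕ.+ (x ℕ.+ sum k)) n * (W 0 l ls * (W 0 (m ∷ʳ y) (ms ∷ʳ e₁) * W (sum l ℕ.+ t) (x ∷ k) (e₂ ∷ ns))))
                    (sum-∷ʳ m y) ⟩
          δ (sum l ℕ.+ Y ℕ.+ (x ℕ.+ sum k)) n * (W 0 l ls * (Wmy * (recip (sum l ℕ.+ Y ℕ.+ x) ^ e₂ * W (sum l ℕ.+ Y ℕ.+ x) k ns)))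
            ≡⟨ cong₂ (λ u v → δ u n * (W 0 l ls * (Wmy * (recip v ^ e₂ * W v k ns))))
                 (swap-middle (sum l) Y x (sum k)) (swap-last (sum l) Y x) ⟩
          d * (W 0 l ls * (Wmy * (recip Z ^ e₂ * Wk)))
            ≡⟨ cong (λ A → d * (W 0 l ls * (A * (recip Z ^ e₂ * Wk)))) (W-∷ʳ 0 m y ms e₁ lm) ⟩
          d * (W 0 l ls * ((W 0 m ms * recip Y ^ e₁) * (recip Z ^ e₂ * Wk)))
            ≡⟨ regroup d (W 0 l ls) (W 0 m ms) (recip Y ^ e₁) (recip Z ^ e₂) Wk ⟩
          Q n l x m y k * (recip Y ^ e₁ * recip Z ^ e₂) ∎)
        where
        open ≡-Reasoning
        Y = sum m ℕ.+ y
        Z = sum l ℕ.+ x ℕ.+ Y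
        d = δ (Z ℕ.+ sum k) n
        Wk = W Z k ns
        Wmy = W 0 (m ∷ʳ y) (ms ∷ʳ e₁)

    li-λ-sem : ∀ e₁ e₂ n → LIsem (ls ∷ʳ e₁) ms (e₂ ∷ ns) 0 n ≈
      Σ5 (λ l x m y k → Q n l x m y k * (recip (sum l ℕ.+ x) ^ e₁ * recip (sum l ℕ.+ x ℕ.+ (sum m ℕ.+ y)) ^ e₂))
    li-λ-sem e₁ e₂ n = ≈-trans (≡⇒≈ reindex) (Σ5-cong termwise)
      where
      body : List ℕ → List ℕ → List ℕ → ℤ
      body l m k = δ (sum l ℕ.+ sum m ℕ.+ sum k) n * (W 0 l (ls ∷ʳ e₁) * (W 0 m ms * W (sum l ℕ.+ sum m) k (e₂ ∷ ns)))
      -- the first entry of the ν-tuple plays the role of y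
      reindex : LIsem (ls ∷ʳ e₁) ms (e₂ ∷ ns) 0 n ≡ Σ5 (λ l x m y k → body (l ∷ʳ x) m (y ∷ k))
      reindex = trans (cong (λ s → Σ (T s) (λ l → Σ (T β) (λ m → Σ (T (suc c)) (λ k → body l m k)))) (length-∷ʳ ls e₁))
        (trans (ΣT-∷ʳ α _) (Σ-cong≡ (T α) λ l → Σ-cong≡ R λ x → Σ-cong≡ (T β) λ m → ΣT-∷ c _))
      regroup : ∀ d Wl iX Wm iZ Wk → d * ((Wl * iX) * (Wm * (iZ * Wk))) ≡ (d * (Wl * (Wm * Wk))) * (iX * iZ)
      regroup = solve-∀
      reassociate : ∀ X M y K → X ℕ.+ M ℕ.+ (y ℕ.+ K) ≡ X ℕ.+ (M ℕ.+ y) ℕ.+ K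
      reassociate = ℕSolver.solve-∀
      termwise : ∀ l x m y k → length l ≡ α → InR x → length m ≡ β → InR y → length k ≡ c →
        body (l ∷ʳ x) m (y ∷ k) ≈ Q n l x m y k * (recip (sum l ℕ.+ x) ^ e₁ * recip (sum l ℕ.+ x ℕ.+ (sum m ℕ.+ y)) ^ e₂)
      termwise l x m y k ll _ lm _ _ = ≡⇒≈ (begin
          body (l ∷ʳ x) m (y ∷ k)
            ≡⟨ cong (λ t → δ (t ℕ.+ sum m ℕ.+ (y ℕ.+ sum k)) n * (W 0 (l ∷ʳ x) (ls ∷ʳ e₁) * (W 0 m ms * W (t ℕ.+ sum m) (y ∷ k) (e₂ ∷ ns))))
                    (sum-∷ʳ l x) ⟩
          δ (X ℕ.+ sum m ℕ.+ (y ℕ.+ sum k)) n * (Wlx * (W 0 m ms * (recip (X ℕ.+ sum m ℕ.+ y) ^ e₂ * W (X ℕ.+ sum m ℕ.+ y) k ns)))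
            ≡⟨ cong₂ (λ u v → δ u n * (Wlx * (W 0 m ms * (recip v ^ e₂ * W v k ns))))
                 (reassociate X (sum m) y (sum k)) (ℕP.+-assoc X (sum m) y) ⟩
          d * (Wlx * (W 0 m ms * (recip Z ^ e₂ * Wk)))
            ≡⟨ cong (λ A → d * (A * (W 0 m ms * (recip Z ^ e₂ * Wk)))) (W-∷ʳ 0 l x ls e₁ ll) ⟩
          d * ((W 0 l ls * recip X ^ e₁) * (W 0 m ms * (recip Z ^ e₂ * Wk)))
            ≡⟨ regroup d (W 0 l ls) (recip X ^ e₁) (W 0 m ms) (recip Z ^ e₂) Wk ⟩
          Q n l x m y k * (recip X ^ e₁ * recip Z ^ e₂) ∎)
        where
        open ≡-Reasoning
        X = sum l ℕ.+ x
        Z = X ℕ.+ (sum m ℕ.+ y)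
        d = δ (Z ℕ.+ sum k) n
        Wk = W Z k ns
        Wlx = W 0 (l ∷ʳ x) (ls ∷ʳ e₁)

    combination-core : ∀ n (U : List ℕ) (cf : ℕ → ℤ) (P : ℕ → Poly) (h : ℕ → ℕ → ℕ → ℤ) →
      (∀ τ → τ ∈ U → ⟦ P τ ⟧ n ≈ Σ5 (λ l x m y k → Q n l x m y k * h τ (sum l ℕ.+ x) (sum m ℕ.+ y))) →
      ⟦ sumP (map (λ τ → scale (ι (cf τ)) (P τ)) U) ⟧ n ≈ Core (λ X Y → Σ U (λ τ → cf τ * h τ X Y)) n
    combination-core n U cf P h hyp = ≈begin
      ⟦ sumP (map (λ τ → scale (ι (cf τ)) (P τ)) U) ⟧ n
        ≡⟨ trans (⟦sumP⟧ (map (λ τ → scale (ι (cf τ)) (P τ)) U) n) (Σ-map _ U _) ⟩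
      Σ U (λ τ → ⟦ scale (ι (cf τ)) (P τ) ⟧ n)
        ≈⟨ Σ-cong∈ U (λ τ τ∈ → ≈-trans (⟦scale⟧ (ι (cf τ)) (P τ) n) (*-cong (val-ι (cf τ)) (hyp τ τ∈))) ⟩
      Σ U (λ τ → cf τ * Σ5 (λ l x m y k → Q n l x m y k * h τ (sum l ℕ.+ x) (sum m ℕ.+ y)))
        ≡⟨ Σ-cong≡ U (λ τ → sym (Σ5-* (cf τ) _)) ⟩
      Σ U (λ τ → Σ5 (λ l x m y k → cf τ * (Q n l x m y k * h τ (sum l ℕ.+ x) (sum m ℕ.+ y))))
        ≡⟨ sym (Σ5-pull U _) ⟩
      Σ5 (λ l x m y k → Σ U (λ τ → cf τ * (Q n l x m y k * h τ (sum l ℕ.+ x) (sum m ℕ.+ y))))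
        ≡⟨ Σ5-cong≡ (λ l x m y k → trans (Σ-cong≡ U (λ τ → swap (cf τ) (Q n l x m y k) _)) (Σ-* U (Q n l x m y k) _)) ⟩
      Core (λ X Y → Σ U (λ τ → cf τ * h τ X Y)) n ≈∎
      where
      open ≈-Reasoning
      swap : ∀ c Q h → c * (Q * h) ≡ Q * (c * h)
      swap = solve-∀

    -- exponents μ_b - τ and λ_a - τ of the first two terms are positive
    positive-∸ : ∀ {e τ} → τ ∈ upTo e → 0 < e ∸ τ
    positive-∸ τ∈ = ℕP.m<n⇒0<n∸m (∈-upTo⁻ τ∈)

    first-sem : ∀ n → ⟦ sumP (map (λ τ → scale (binom (la ∸ 1 ℕ.+ τ) τ) (li ls (ms ∷ʳ (mb ∸ τ)) ((la ℕ.+ τ) ∷ ns) p)) (upTo mb)) ⟧ n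
                      ≈ Core pfμ n
    first-sem n = combination-core n (upTo mb) (λ τ → + ((la ∸ 1 ℕ.+ τ) C τ))
       (λ τ → li ls (ms ∷ʳ (mb ∸ τ)) ((la ℕ.+ τ) ∷ ns) p)
       (λ τ X Y → recip Y ^ (mb ∸ τ) * recip (X ℕ.+ Y) ^ (la ℕ.+ τ))
       (λ τ τ∈ → ≈-trans (li-sem ls (ms ∷ʳ (mb ∸ τ)) ((la ℕ.+ τ) ∷ ns) 0 n
                    (AllP.++⁺ posl (AllP.++⁺ (AllP.∷ʳ⁺ posm (positive-∸ τ∈)) (s≤s z≤n ∷ posn))))
                  (li-μ-sem (mb ∸ τ) (la ℕ.+ τ) n))

    second-sem : ∀ n → ⟦ sumP (map (λ τ → scale (binom (mb ∸ 1 ℕ.+ τ) τ) (li (ls ∷ʳ (la ∸ τ)) ms ((mb ℕ.+ τ) ∷ ns) p)) (upTo la)) ⟧ n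
                       ≈ Core pfλ n
    second-sem n = combination-core n (upTo la) (λ τ → + ((mb ∸ 1 ℕ.+ τ) C τ))
       (λ τ → li (ls ∷ʳ (la ∸ τ)) ms ((mb ℕ.+ τ) ∷ ns) p)
       (λ τ X Y → recip X ^ (la ∸ τ) * recip (X ℕ.+ Y) ^ (mb ℕ.+ τ))
       (λ τ τ∈ → ≈-trans (li-sem (ls ∷ʳ (la ∸ τ)) ms ((mb ℕ.+ τ) ∷ ns) 0 n
                    (AllP.++⁺ (AllP.∷ʳ⁺ posl (positive-∸ τ∈)) (AllP.++⁺ posm (s≤s z≤n ∷ posn))))
                  (li-λ-sem (la ∸ τ) (mb ℕ.+ τ) n))

    -- Fixing l (resp. m), the sum over x (resp. y)
    -- of [p ∣ X] G(X) is resummed by the distribution lemma into blocks, and the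
    -- remaining sum at X = jp is li over ms ++ (λ_a + μ_b) ∷ ns shifted by T^(jp).
    C₄ C₅ : ℤ
    C₄ = + ((suc a ℕ.+ suc b ∸ 1) C suc a)
    C₅ = + ((suc a ℕ.+ suc b ∸ 1) C suc b)

    private
      Σmyk-* : ∀ (d : ℤ) (f : List ℕ → ℕ → List ℕ → ℤ) →
        Σ (T β) (λ m → Σ R (λ y → Σ (T c) (λ k → d * f m y k))) ≡ d * Σ (T β) (λ m → Σ R (λ y → Σ (T c) (λ k → f m y k)))
      Σmyk-* d f = trans (Σ-cong≡ (T β) λ m → trans (Σ-cong≡ R λ y → Σ-* (T c) d (f m y)) (Σ-* R d _)) (Σ-* (T β) d _)

      Σlxk-* : ∀ (d : ℤ) (f : List ℕ → ℕ → List ℕ → ℤ) →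
        Σ (T α) (λ l → Σ R (λ x → Σ (T c) (λ k → d * f l x k))) ≡ d * Σ (T α) (λ l → Σ R (λ x → Σ (T c) (λ k → f l x k)))
      Σlxk-* d f = trans (Σ-cong≡ (T α) λ l → trans (Σ-cong≡ R λ x → Σ-* (T c) d (f l x)) (Σ-* R d _)) (Σ-* (T α) d _)

      pull-constant : ∀ Q χ C E → Q * (χ * (C * E)) ≡ C * (χ * (Q * E))
      pull-constant = solve-∀

      reassociate : ∀ χ Wl L → χ * (Wl * L) ≡ (χ * Wl) * L
      reassociate = solve-∀

    G₄ : ℕ → List ℕ → ℕ → ℤ
    G₄ n l X = Σ (T β) λ m → Σ R λ y → Σ (T c) λ k →
       δ (X ℕ.+ (sum m ℕ.+ y) ℕ.+ sum k) n * (W 0 l ls * (W 0 m ms * W (X ℕ.+ (sum m ℕ.+ y)) k ns)) * recip (sum m ℕ.+ y) ^ eL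

    G₄-multiple : ∀ n l j → G₄ n l (p ℕ.* j) ≈ W 0 l ls * LK (ms ++ eL ∷ ns) (p ℕ.* j) n
    G₄-multiple n l j = ≈-trans (ΣT-cong β (λ m lm _ → Σ-cong R (λ y → Σ-cong (T c) (λ k → termwise m y k lm))))
        (≈-trans (≡⇒≈ (Σmyk-* (W 0 l ls) _)) (*-cong (≈-refl {W 0 l ls}) (≡⇒≈ (sym merged))))
      where
      body : List ℕ → ℤ
      body t = δ (p ℕ.* j ℕ.+ sum t) n * W 0 t (ms ++ eL ∷ ns)
      merged : LK (ms ++ eL ∷ ns) (p ℕ.* j) n ≡ Σ (T β) λ m → Σ R λ y → Σ (T c) λ k → body (m ++ y ∷ k)
      merged = trans (cong (λ s → Σ (T s) body) (LP.length-++ ms)) (trans (ΣT-++ β (suc c) body)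
                 (Σ-cong≡ (T β) (λ m → ΣT-∷ c _)))
      regroup : ∀ d Wl Wm Wk E → d * (Wl * (Wm * Wk)) * E ≡ Wl * (d * (Wm * (E * Wk)))
      regroup = solve-∀
      termwise : ∀ m y k → length m ≡ β →
         δ (p ℕ.* j ℕ.+ (sum m ℕ.+ y) ℕ.+ sum k) n * (W 0 l ls * (W 0 m ms * W (p ℕ.* j ℕ.+ (sum m ℕ.+ y)) k ns))
           * recip (sum m ℕ.+ y) ^ eL
         ≈ W 0 l ls * body (m ++ y ∷ k)
      termwise m y k lm = ≈-trans
        (*-cong (*-cong (≈-refl {d}) (*-cong (≈-refl {W 0 l ls}) (*-cong (≈-refl {W 0 m ms})
                  (W-shift (p ℕ.* j ℕ.+ Y) Y k ns (+-p∣ˡ (ℕD.m∣m*n j))))))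
                (≈-refl {recip Y ^ eL}))
        (≡⇒≈ (trans (regroup d (W 0 l ls) (W 0 m ms) (W Y k ns) (recip Y ^ eL))
          (cong (W 0 l ls *_) (sym (cong₂ _*_ δ-merged (W-++ 0 m (y ∷ k) ms (eL ∷ ns) lm))))))
        where
        Y = sum m ℕ.+ y
        d = δ (p ℕ.* j ℕ.+ Y ℕ.+ sum k) n
        δ-merged : δ (p ℕ.* j ℕ.+ sum (m ++ y ∷ k)) n ≡ d
        δ-merged = cong (λ z → δ z n) (trans (cong (p ℕ.* j ℕ.+_) (trans (sum-++ m (y ∷ k)) (sym (ℕP.+-assoc (sum m) y (sum k)))))
                                             (sym (ℕP.+-assoc (p ℕ.* j) Y (sum k))))

    fourth-core : ∀ n → Core (λ X Y → χp X * boundaryX X Y) n ≈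
                        C₄ * Σ (oneTo α) (λ j → val (ζA j ls p) * LK (ms ++ eL ∷ ns) (p ℕ.* j) n)
    fourth-core n = ≈begin
      Core (λ X Y → χp X * boundaryX X Y) n
        ≡⟨ trans (Σ5-cong≡ (λ l x m y k → pull-constant (Q n l x m y k) (χp (sum l ℕ.+ x)) C₄ (recip (sum m ℕ.+ y) ^ eL)))
                 (Σ5-* C₄ _) ⟩
      C₄ * Σ5 (λ l x m y k → χp (sum l ℕ.+ x) * (Q n l x m y k * recip (sum m ℕ.+ y) ^ eL))
        ≡⟨ cong (C₄ *_) (Σ-cong≡ (T α) λ l → Σ-cong≡ R λ x → Σmyk-* (χp (sum l ℕ.+ x)) _) ⟩
      C₄ * Σ (T α) (λ l → Σ R (λ x → χp (sum l ℕ.+ x) * G₄ n l (sum l ℕ.+ x)))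
        ≈⟨ *-cong (≈-refl {C₄}) (ΣT-cong α (λ l ll al → distribution α (sum l) (G₄ n l) (sum-InR≤ l α ll al))) ⟩
      C₄ * Σ (T α) (λ l → Σ (oneTo α) (λ j → χ (inBlock j (sum l)) * G₄ n l (p ℕ.* j)))
        ≈⟨ *-cong (≈-refl {C₄}) (Σ-cong (T α) (λ l → Σ-cong (oneTo α) (λ j →
             *-cong (≈-refl {χ (inBlock j (sum l))}) (G₄-multiple n l j)))) ⟩
      C₄ * Σ (T α) (λ l → Σ (oneTo α) (λ j → χ (inBlock j (sum l)) * (W 0 l ls * LK (ms ++ eL ∷ ns) (p ℕ.* j) n)))
        ≡⟨ cong (C₄ *_) (trans (Σ-comm (T α) (oneTo α) _) (Σ-cong≡ (oneTo α) (λ j →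
              trans (Σ-cong≡ (T α) (λ l → reassociate (χ (inBlock j (sum l))) (W 0 l ls) (LK (ms ++ eL ∷ ns) (p ℕ.* j) n)))
                    (Σ-*ʳ (T α) (LK (ms ++ eL ∷ ns) (p ℕ.* j) n) _)))) ⟩
      C₄ * Σ (oneTo α) (λ j → Σ (T α) (λ l → χ (inBlock j (sum l)) * W 0 l ls) * LK (ms ++ eL ∷ ns) (p ℕ.* j) n)
        ≈⟨ *-cong (≈-refl {C₄}) (Σ-cong (oneTo α) (λ j →
             *-cong (≈-sym (ζ-sem j ls posl)) (≈-refl {LK (ms ++ eL ∷ ns) (p ℕ.* j) n}))) ⟩
      C₄ * Σ (oneTo α) (λ j → val (ζA j ls p) * LK (ms ++ eL ∷ ns) (p ℕ.* j) n) ≈∎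
      where open ≈-Reasoning

    G₅ : ℕ → List ℕ → ℕ → ℤ
    G₅ n m Y = Σ (T α) λ l → Σ R λ x → Σ (T c) λ k →
       δ (sum l ℕ.+ x ℕ.+ Y ℕ.+ sum k) n * (W 0 l ls * (W 0 m ms * W (sum l ℕ.+ x ℕ.+ Y) k ns)) * recip (sum l ℕ.+ x) ^ eL

    G₅-multiple : ∀ n m j → G₅ n m (p ℕ.* j) ≈ W 0 m ms * LK (ls ++ eL ∷ ns) (p ℕ.* j) n
    G₅-multiple n m j = ≈-trans (ΣT-cong α (λ l ll _ → Σ-cong R (λ x → Σ-cong (T c) (λ k → termwise l x k ll))))
        (≈-trans (≡⇒≈ (Σlxk-* (W 0 m ms) _)) (*-cong (≈-refl {W 0 m ms}) (≡⇒≈ (sym merged))))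
      where
      body : List ℕ → ℤ
      body t = δ (p ℕ.* j ℕ.+ sum t) n * W 0 t (ls ++ eL ∷ ns)
      merged : LK (ls ++ eL ∷ ns) (p ℕ.* j) n ≡ Σ (T α) λ l → Σ R λ x → Σ (T c) λ k → body (l ++ x ∷ k)
      merged = trans (cong (λ s → Σ (T s) body) (LP.length-++ ls)) (trans (ΣT-++ α (suc c) body)
                 (Σ-cong≡ (T α) (λ l → ΣT-∷ c _)))
      regroup : ∀ d Wl Wm Wk E → d * (Wl * (Wm * Wk)) * E ≡ Wm * (d * (Wl * (E * Wk)))
      regroup = solve-∀
      rotate : ∀ L x P K → L ℕ.+ x ℕ.+ P ℕ.+ K ≡ P ℕ.+ (L ℕ.+ (x ℕ.+ K))
      rotate = ℕSolver.solve-∀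
      termwise : ∀ l x k → length l ≡ α →
         δ (sum l ℕ.+ x ℕ.+ p ℕ.* j ℕ.+ sum k) n * (W 0 l ls * (W 0 m ms * W (sum l ℕ.+ x ℕ.+ p ℕ.* j) k ns))
           * recip (sum l ℕ.+ x) ^ eL
         ≈ W 0 m ms * body (l ++ x ∷ k)
      termwise l x k ll = ≈-trans
        (*-cong (*-cong (≈-refl {d}) (*-cong (≈-refl {W 0 l ls}) (*-cong (≈-refl {W 0 m ms})
                  (W-shift (X ℕ.+ p ℕ.* j) X k ns (+-p∣ʳ (ℕD.m∣m*n j))))))
                (≈-refl {recip X ^ eL}))
        (≡⇒≈ (trans (regroup d (W 0 l ls) (W 0 m ms) (W X k ns) (recip X ^ eL))
          (cong (W 0 m ms *_) (sym (cong₂ _*_ δ-merged (W-++ 0 l (x ∷ k) ls (eL ∷ ns) ll))))))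
        where
        X = sum l ℕ.+ x
        d = δ (X ℕ.+ p ℕ.* j ℕ.+ sum k) n
        δ-merged : δ (p ℕ.* j ℕ.+ sum (l ++ x ∷ k)) n ≡ d
        δ-merged = cong (λ z → δ z n) (trans (cong (p ℕ.* j ℕ.+_) (sum-++ l (x ∷ k))) (sym (rotate (sum l) x (p ℕ.* j) (sum k))))

    Σ5-swap : ∀ (f : F5) → Σ5 f ≡ Σ (T β) λ m → Σ R λ y → Σ (T α) λ l → Σ R λ x → Σ (T c) λ k → f l x m y k
    Σ5-swap f = trans (Σ-cong≡ (T α) (λ l → Σ-comm R (T β) _)) (trans (Σ-comm (T α) (T β) _)
       (Σ-cong≡ (T β) (λ m → trans (Σ-cong≡ (T α) (λ l → Σ-comm R R _)) (Σ-comm (T α) R _))))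

    fifth-core : ∀ n → Core (λ X Y → χp Y * boundaryY X Y) n ≈
                       C₅ * Σ (oneTo β) (λ j → val (ζA j ms p) * LK (ls ++ eL ∷ ns) (p ℕ.* j) n)
    fifth-core n = ≈begin
      Core (λ X Y → χp Y * boundaryY X Y) n
        ≡⟨ trans (Σ5-cong≡ (λ l x m y k → pull-constant (Q n l x m y k) (χp (sum m ℕ.+ y)) C₅ (recip (sum l ℕ.+ x) ^ eL)))
                 (Σ5-* C₅ _) ⟩
      C₅ * Σ5 (λ l x m y k → χp (sum m ℕ.+ y) * (Q n l x m y k * recip (sum l ℕ.+ x) ^ eL))
        ≡⟨ cong (C₅ *_) (trans (Σ5-swap _) (Σ-cong≡ (T β) λ m → Σ-cong≡ R λ y → Σlxk-* (χp (sum m ℕ.+ y)) _)) ⟩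
      C₅ * Σ (T β) (λ m → Σ R (λ y → χp (sum m ℕ.+ y) * G₅ n m (sum m ℕ.+ y)))
        ≈⟨ *-cong (≈-refl {C₅}) (ΣT-cong β (λ m lm am → distribution β (sum m) (G₅ n m) (sum-InR≤ m β lm am))) ⟩
      C₅ * Σ (T β) (λ m → Σ (oneTo β) (λ j → χ (inBlock j (sum m)) * G₅ n m (p ℕ.* j)))
        ≈⟨ *-cong (≈-refl {C₅}) (Σ-cong (T β) (λ m → Σ-cong (oneTo β) (λ j →
             *-cong (≈-refl {χ (inBlock j (sum m))}) (G₅-multiple n m j)))) ⟩
      C₅ * Σ (T β) (λ m → Σ (oneTo β) (λ j → χ (inBlock j (sum m)) * (W 0 m ms * LK (ls ++ eL ∷ ns) (p ℕ.* j) n)))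
        ≡⟨ cong (C₅ *_) (trans (Σ-comm (T β) (oneTo β) _) (Σ-cong≡ (oneTo β) (λ j →
              trans (Σ-cong≡ (T β) (λ m → reassociate (χ (inBlock j (sum m))) (W 0 m ms) (LK (ls ++ eL ∷ ns) (p ℕ.* j) n)))
                    (Σ-*ʳ (T β) (LK (ls ++ eL ∷ ns) (p ℕ.* j) n) _)))) ⟩
      C₅ * Σ (oneTo β) (λ j → Σ (T β) (λ m → χ (inBlock j (sum m)) * W 0 m ms) * LK (ls ++ eL ∷ ns) (p ℕ.* j) n)
        ≈⟨ *-cong (≈-refl {C₅}) (Σ-cong (oneTo β) (λ j →
             *-cong (≈-sym (ζ-sem j ms posm)) (≈-refl {LK (ls ++ eL ∷ ns) (p ℕ.* j) n}))) ⟩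
      C₅ * Σ (oneTo β) (λ j → val (ζA j ms p) * LK (ls ++ eL ∷ ns) (p ℕ.* j) n) ≈∎
      where open ≈-Reasoning

    -- Here the full tuple m = m₁ ∷ w is kept: for fixed l, x, w
    -- the condition p ∣ X + Y concerns the first entry m₁, the reversal lemma
    -- turns the weight of m into that of reverse w read from X, and the
    -- distribution lemma resums over m₁.  The result is the reading of
    -- ζ_A(λ ⋆ μ), where λ ⋆ μ = ls ++ (λ_a + μ_b) ∷ reverse ms.
    κ : List ℕ
    κ = ls ++ eL ∷ reverse ms

    r₃ : ℕ
    r₃ = α ℕ.+ β ℕ.+ 1

    sgnμ : ℤ
    sgnμ = sgn (sum ms ℕ.+ mb)

    third-summand : ℕ → List ℕ → ℕ → List ℕ → List ℕ → ℤ
    third-summand n l x m k = χp (sum l ℕ.+ x ℕ.+ sum m) * (δ (sum l ℕ.+ x ℕ.+ sum m ℕ.+ sum k) n *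
        ((W 0 l ls * recip (sum l ℕ.+ x) ^ la) * (W 0 m (ms ∷ʳ mb) * W (sum l ℕ.+ x ℕ.+ sum m) k ns)))

    third-expand : ∀ n → Core (λ X Y → χp (X ℕ.+ Y) * leading X Y) n ≈
      Σ (T α) λ l → Σ R λ x → Σ R λ m₁ → Σ (T β) λ w → Σ (T c) λ k → third-summand n l x (m₁ ∷ w) k
    third-expand n = ≈-trans (Σ5-cong termwise) (≡⇒≈ (Σ-cong≡ (T α) λ l → Σ-cong≡ R λ x →
               trans (sym (ΣT-∷ʳ β (λ m → Σ (T c) (λ k → third-summand n l x m k)))) (ΣT-∷ β _)))
      where
      regroup : ∀ d Wl iX Wm iY Wk χ → (d * (Wl * (Wm * Wk))) * (χ * (iX * iY)) ≡ χ * (d * ((Wl * iX) * ((Wm * iY) * Wk)))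
      regroup = solve-∀
      termwise : ∀ l x m y k → length l ≡ α → InR x → length m ≡ β → InR y → length k ≡ c →
        Q n l x m y k * (χp (sum l ℕ.+ x ℕ.+ (sum m ℕ.+ y)) * leading (sum l ℕ.+ x) (sum m ℕ.+ y)) ≈ third-summand n l x (m ∷ʳ y) k
      termwise l x m y k _ _ lm _ _ = ≡⇒≈ (begin
          Q n l x m y k * (χp Z * leading X Y)
            ≡⟨ regroup (δ (Z ℕ.+ sum k) n) (W 0 l ls) (recip X ^ la) (W 0 m ms) (recip Y ^ mb) (W Z k ns) (χp Z) ⟩
          χp Z * (δ (Z ℕ.+ sum k) n * ((W 0 l ls * recip X ^ la) * ((W 0 m ms * recip Y ^ mb) * W Z k ns)))
            ≡⟨ cong (λ A → χp Z * (δ (Z ℕ.+ sum k) n * ((W 0 l ls * recip X ^ la) * (A * W Z k ns)))) (W-∷ʳ 0 m y ms mb lm) ⟨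
          χp Z * (δ (Z ℕ.+ sum k) n * ((W 0 l ls * recip X ^ la) * (W 0 (m ∷ʳ y) (ms ∷ʳ mb) * W Z k ns)))
            ≡⟨ cong (λ s → χp (X ℕ.+ s) * (δ (X ℕ.+ s ℕ.+ sum k) n *
                 ((W 0 l ls * recip X ^ la) * (W 0 (m ∷ʳ y) (ms ∷ʳ mb) * W (X ℕ.+ s) k ns)))) (sum-∷ʳ m y) ⟨
          third-summand n l x (m ∷ʳ y) k ∎)
        where
        open ≡-Reasoning
        X = sum l ℕ.+ x
        Y = sum m ℕ.+ y
        Z = X ℕ.+ Y

    W⋆ : List ℕ → ℕ → List ℕ → ℤ
    W⋆ l x w = W 0 l ls * (recip (sum l ℕ.+ x) ^ eL * W (sum l ℕ.+ x) (reverse w) (reverse ms))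

    -- the sum of l ++ x ∷ w, that is L_a + M_b - m₁
    A⋆ : List ℕ → ℕ → List ℕ → ℕ
    A⋆ l x w = sum l ℕ.+ x ℕ.+ sum w

    third-reverse : ∀ n l x m₁ w k → length w ≡ β →
      third-summand n l x (m₁ ∷ w) k ≈
      χp (A⋆ l x w ℕ.+ m₁) * (sgnμ * W⋆ l x w * (δ (A⋆ l x w ℕ.+ m₁ ℕ.+ sum k) n * W (A⋆ l x w ℕ.+ m₁) k ns))
    third-reverse n l x m₁ w k lw =
      ≈-trans (≡⇒≈ (cong (λ s → χp s * (δ (s ℕ.+ sum k) n * ((W 0 l ls * recip X ^ la) * (W 0 (m₁ ∷ w) (ms ∷ʳ mb) * W s k ns))))
                         (reorder X m₁ (sum w))))
              (by-divisibility (p ℕD.∣? S))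
      where
      reorder : ∀ X m W → X ℕ.+ (m ℕ.+ W) ≡ X ℕ.+ W ℕ.+ m
      reorder = ℕSolver.solve-∀
      X = sum l ℕ.+ x
      S = A⋆ l x w ℕ.+ m₁
      tail-part = δ (S ℕ.+ sum k) n * W S k ns
      summand = δ (S ℕ.+ sum k) n * ((W 0 l ls * recip X ^ la) * (W 0 (m₁ ∷ w) (ms ∷ʳ mb) * W S k ns))
      regroup : ∀ d Wl iXa Sg iXb Wr Wk → d * ((Wl * iXa) * ((Sg * iXb * Wr) * Wk)) ≡ (Sg * (Wl * ((iXa * iXb) * Wr))) * (d * Wk)
      regroup = solve-∀
      by-divisibility : Dec (p ℕD.∣ S) → χp S * summand ≈ χp S * (sgnμ * W⋆ l x w * tail-part)
      by-divisibility (no h) = ≡⇒≈ (trans (cong (_* summand) (χp-no h)) (sym (cong (_* (sgnμ * W⋆ l x w * tail-part)) (χp-no h))))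
      by-divisibility (yes h) = *-cong (≈-refl {χp S}) (≈begin
          summand
            ≈⟨ *-cong (≈-refl {δ (S ℕ.+ sum k) n}) (*-cong (≈-refl {W 0 l ls * recip X ^ la})
                 (*-cong (reversal 0 X m₁ w ms mb (sym lw) h') (≈-refl {W S k ns}))) ⟩
          δ (S ℕ.+ sum k) n * ((W 0 l ls * recip X ^ la) * ((sgnμ * recip X ^ mb * W X (reverse w) (reverse ms)) * W S k ns))
            ≡⟨ regroup (δ (S ℕ.+ sum k) n) (W 0 l ls) (recip X ^ la) sgnμ (recip X ^ mb) (W X (reverse w) (reverse ms)) (W S k ns) ⟩
          (sgnμ * (W 0 l ls * ((recip X ^ la * recip X ^ mb) * W X (reverse w) (reverse ms)))) * tail-part
            ≡⟨ cong (λ z → (sgnμ * (W 0 l ls * (z * W X (reverse w) (reverse ms)))) * tail-part)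
                    (sym (ℤP.^-distribˡ-+-* (recip X) la mb)) ⟩
          sgnμ * W⋆ l x w * tail-part ≈∎)
        where
        open ≈-Reasoning
        h' : p ℕD.∣ (X ℕ.+ 0 ℕ.+ m₁ ℕ.+ sum w)
        h' = subst (p ℕD.∣_) (shuffle X m₁ (sum w)) h
          where
          shuffle : ∀ X m W → X ℕ.+ W ℕ.+ m ≡ X ℕ.+ 0 ℕ.+ m ℕ.+ W
          shuffle = ℕSolver.solve-∀

    G₃ : ℕ → ℕ → ℤ
    G₃ n Z = Σ (T c) λ k → δ (Z ℕ.+ sum k) n * W Z k ns

    G₃-multiple : ∀ n i → G₃ n (p ℕ.* i) ≈ LK ns (p ℕ.* i) n
    G₃-multiple n i = Σ-cong (T c) (λ k → *-cong (≈-refl {δ (p ℕ.* i ℕ.+ sum k) n})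
                        (W-shift (p ℕ.* i) 0 k ns (p∣⇒≈0 (ℕD.m∣m*n i))))

    A⋆-bound : ∀ l x w → length l ≡ α → All InR l → InR x → length w ≡ β → All InR w → A⋆ l x w ≤ r₃ ℕ.* (p ∸ 1)
    A⋆-bound l x w ll al ix lw aw =
      ℕP.≤-trans (ℕP.+-mono-≤ (ℕP.+-mono-≤ (sum-InR≤ l α ll al) (InR⇒≤ ix)) (sum-InR≤ w β lw aw))
                 (ℕP.≤-reflexive (collect α β (p ∸ 1)))
      where
      collect : ∀ α β q → α ℕ.* q ℕ.+ q ℕ.+ β ℕ.* q ≡ (α ℕ.+ β ℕ.+ 1) ℕ.* q
      collect = ℕSolver.solve-∀

    third-distribute : ∀ n → (Σ (T α) λ l → Σ R λ x → Σ R λ m₁ → Σ (T β) λ w → Σ (T c) λ k → third-summand n l x (m₁ ∷ w) k) ≈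
       Σ (T α) λ l → Σ R λ x → Σ (T β) λ w → sgnμ * W⋆ l x w * Σ (oneTo r₃) (λ i → χ (inBlock i (A⋆ l x w)) * LK ns (p ℕ.* i) n)
    third-distribute n = ΣT-cong α λ l ll al → Σ-cong∈ R λ x x∈ →
      ≈-trans (Σ-cong R (λ m₁ → ΣT-cong β (λ w lw _ → Σ-cong (T c) (λ k → third-reverse n l x m₁ w k lw))))
      (≈-trans (≡⇒≈ (Σ-comm R (T β) _))
      (ΣT-cong β λ w lw aw → ≈-trans (≡⇒≈ (factor l x w))
        (*-cong (≈-refl {V l x w}) (≈-trans (distribution r₃ (A⋆ l x w) (G₃ n) (A⋆-bound l x w ll al (range-InR x∈) lw aw))
          (Σ-cong (oneTo r₃) (λ i → *-cong (≈-refl {χ (inBlock i (A⋆ l x w))}) (G₃-multiple n i)))))))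
      where
      V : List ℕ → ℕ → List ℕ → ℤ
      V l x w = sgnμ * W⋆ l x w
      swap : ∀ χ V D → χ * (V * D) ≡ V * (χ * D)
      swap = solve-∀
      factor : ∀ l x w → Σ R (λ m₁ → Σ (T c) (λ k → χp (A⋆ l x w ℕ.+ m₁) * (V l x w *
                           (δ (A⋆ l x w ℕ.+ m₁ ℕ.+ sum k) n * W (A⋆ l x w ℕ.+ m₁) k ns))))
                       ≡ V l x w * Σ R (λ m₁ → χp (A⋆ l x w ℕ.+ m₁) * G₃ n (A⋆ l x w ℕ.+ m₁))
      factor l x w = trans (Σ-cong≡ R (λ m₁ →
            trans (Σ-cong≡ (T c) (λ k → swap (χp (A⋆ l x w ℕ.+ m₁)) (V l x w) _))
              (trans (Σ-* (T c) (V l x w) _) (cong (V l x w *_) (Σ-* (T c) (χp (A⋆ l x w ℕ.+ m₁)) _)))))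
            (Σ-* R (V l x w) (λ m₁ → χp (A⋆ l x w ℕ.+ m₁) * G₃ n (A⋆ l x w ℕ.+ m₁)))

    Σ3 : (List ℕ → ℕ → List ℕ → ℤ) → ℤ
    Σ3 f = Σ (T α) λ l → Σ R λ x → Σ (T β) λ w → f l x w

    Σ3-*ʳ : ∀ (d : ℤ) (f : List ℕ → ℕ → List ℕ → ℤ) → Σ3 (λ l x w → f l x w * d) ≡ Σ3 f * d
    Σ3-*ʳ d f = trans (Σ-cong≡ (T α) λ l → trans (Σ-cong≡ R λ x → Σ-*ʳ (T β) d (f l x)) (Σ-*ʳ R d _)) (Σ-*ʳ (T α) d _)

    Σ3-* : ∀ (d : ℤ) (f : List ℕ → ℕ → List ℕ → ℤ) → Σ3 (λ l x w → d * f l x w) ≡ d * Σ3 f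
    Σ3-* d f = trans (Σ-cong≡ (T α) λ l → trans (Σ-cong≡ R λ x → Σ-* (T β) d (f l x)) (Σ-* R d _)) (Σ-* (T α) d _)

    Σ3-pull : ∀ {A : Set} (U : List A) (f : A → List ℕ → ℕ → List ℕ → ℤ) →
              Σ3 (λ l x w → Σ U (λ i → f i l x w)) ≡ Σ U (λ i → Σ3 (f i))
    Σ3-pull U f = trans (Σ-cong≡ (T α) λ l → trans (Σ-cong≡ R λ x → Σ-comm (T β) U _) (Σ-comm R U _)) (Σ-comm (T α) U _)

    -- the reading of ζ_A^(i)(λ ⋆ μ): the tuple for κ splits as l ++ x ∷ reverse w
    ζ⋆-sem : ∀ i → val (ζA i κ p) ≈ Σ3 (λ l x w → χ (inBlock i (A⋆ l x w)) * W⋆ l x w)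
    ζ⋆-sem i = ≈-trans (ζ-sem i κ (AllP.++⁺ posl (s≤s z≤n ∷ All-resp-↭ (↭-sym (↭-reverse ms)) posm)))
       (≈-trans (≡⇒≈ (trans (cong (λ s → Σ (T s) body) (trans (LP.length-++ ls) (cong (λ z → α ℕ.+ suc z) (LP.length-reverse ms))))
          (trans (ΣT-++ α (suc β) body) (Σ-cong≡ (T α) (λ l → trans (ΣT-∷ β _) (Σ-cong≡ R (λ x → ΣT-reverse β _)))))))
        (ΣT-cong α (λ l ll _ → Σ-cong R (λ x → Σ-cong (T β) (λ w → ≡⇒≈ (split l x w ll))))))
      where
      body : List ℕ → ℤ
      body t = χ (inBlock i (sum t)) * W 0 t κ
      split : ∀ l x w → length l ≡ α → body (l ++ x ∷ reverse w) ≡ χ (inBlock i (A⋆ l x w)) * W⋆ l x w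
      split l x w ll = cong₂ _*_ (cong (λ s → χ (inBlock i s)) (trans (sum-++ l (x ∷ reverse w))
                         (trans (cong (λ z → sum l ℕ.+ (x ℕ.+ z)) (sum-reverse w)) (sym (ℕP.+-assoc (sum l) x (sum w))))))
                       (W-++ 0 l (x ∷ reverse w) ls (eL ∷ reverse ms) ll)

    third-term : ℕ → ℤ
    third-term n = sgnμ * Σ (oneTo r₃) (λ i → Σ3 (λ l x w → χ (inBlock i (A⋆ l x w)) * W⋆ l x w) * LK ns (p ℕ.* i) n)

    third-sem : ∀ n → ⟦ scale (ι (sgn (sum (ms ∷ʳ mb)))) (ζsum r₃ κ p ⊛ liₖ ns p) ⟧ n ≈ third-term n
    third-sem n = ≈-trans (⟦scale⟧ (ι (sgn (sum (ms ∷ʳ mb)))) (ζsum r₃ κ p ⊛ liₖ ns p) n)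
      (*-cong (≈-trans (val-ι (sgn (sum (ms ∷ʳ mb)))) (≡⇒≈ (cong sgn (sum-∷ʳ ms mb))))
        (≈-trans (ζsum⊛-sem r₃ κ (liₖ ns p) n) (Σ-cong (oneTo r₃) (λ i → *-cong (ζ⋆-sem i) (liₖ-sem ns (p ℕ.* i) n posn)))))

    third-core : ∀ n → Core (λ X Y → χp (X ℕ.+ Y) * leading X Y) n ≈ third-term n
    third-core n = ≈-trans (third-expand n) (≈-trans (third-distribute n) (≡⇒≈ (begin
        Σ3 (λ l x w → sgnμ * W⋆ l x w * Σ (oneTo r₃) (λ i → χ (inBlock i (A⋆ l x w)) * L i))
          ≡⟨ Σ-cong≡ (T α) (λ l → Σ-cong≡ R (λ x → Σ-cong≡ (T β) (λ w →
               trans (ℤP.*-assoc sgnμ (W⋆ l x w) _)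
                 (trans (cong (sgnμ *_) (sym (Σ-* (oneTo r₃) (W⋆ l x w) _))) (sym (Σ-* (oneTo r₃) sgnμ _)))))) ⟩
        Σ3 (λ l x w → Σ (oneTo r₃) (λ i → sgnμ * (W⋆ l x w * (χ (inBlock i (A⋆ l x w)) * L i))))
          ≡⟨ Σ3-pull (oneTo r₃) _ ⟩
        Σ (oneTo r₃) (λ i → Σ3 (λ l x w → sgnμ * (W⋆ l x w * (χ (inBlock i (A⋆ l x w)) * L i))))
          ≡⟨ Σ-cong≡ (oneTo r₃) (λ i → trans (Σ-cong≡ (T α) (λ l → Σ-cong≡ R (λ x → Σ-cong≡ (T β) (λ w →
                move-out sgnμ (W⋆ l x w) (χ (inBlock i (A⋆ l x w))) (L i))))) (Σ3-*ʳ (L i) _)) ⟩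
        Σ (oneTo r₃) (λ i → Σ3 (λ l x w → χ (inBlock i (A⋆ l x w)) * (sgnμ * W⋆ l x w)) * L i)
          ≡⟨ Σ-cong≡ (oneTo r₃) (λ i → cong (_* L i) (trans (Σ-cong≡ (T α) (λ l → Σ-cong≡ R (λ x → Σ-cong≡ (T β) (λ w →
                swap (χ (inBlock i (A⋆ l x w))) sgnμ (W⋆ l x w))))) (Σ3-* sgnμ _))) ⟩
        Σ (oneTo r₃) (λ i → sgnμ * Σ3 (λ l x w → χ (inBlock i (A⋆ l x w)) * W⋆ l x w) * L i)
          ≡⟨ trans (Σ-cong≡ (oneTo r₃) (λ i → ℤP.*-assoc sgnμ (Σ3 (λ l x w → χ (inBlock i (A⋆ l x w)) * W⋆ l x w)) (L i)))
                   (Σ-* (oneTo r₃) sgnμ _) ⟩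
        third-term n ∎)))
      where
      open ≡-Reasoning
      L : ℕ → ℤ
      L i = LK ns (p ℕ.* i) n
      move-out : ∀ s W χ L → s * (W * (χ * L)) ≡ (χ * (s * W)) * L
      move-out = solve-∀
      swap : ∀ χ s W → χ * (s * W) ≡ s * (χ * W)
      swap = solve-∀

    lhsP firstP secondP thirdP fourthP fifthP rhsP : Poly
    lhsP = li (ls ∷ʳ la) (ms ∷ʳ mb) ns p
    firstP = sumP (map (λ τ → scale (binom (la ∸ 1 ℕ.+ τ) τ) (li ls (ms ∷ʳ (mb ∸ τ)) ((la ℕ.+ τ) ∷ ns) p)) (upTo mb))
    secondP = sumP (map (λ τ → scale (binom (mb ∸ 1 ℕ.+ τ) τ) (li (ls ∷ʳ (la ∸ τ)) ms ((mb ℕ.+ τ) ∷ ns) p)) (upTo la))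
    thirdP = scale (ι (sgn (sum (ms ∷ʳ mb)))) (ζsum r₃ κ p ⊛ liₖ ns p)
    fourthP = ⊖ scale (binom (la ℕ.+ mb ∸ 1) la) (ζsum α ls p ⊛ liₖ (ms ++ eL ∷ ns) p)
    fifthP = ⊖ scale (binom (la ℕ.+ mb ∸ 1) mb) (ζsum β ms p ⊛ liₖ (ls ++ eL ∷ ns) p)
    rhsP = firstP ⊕ secondP ⊕ thirdP ⊕ fourthP ⊕ fifthP

    fourth-sem : ∀ n → ⟦ fourthP ⟧ n ≈ - Core (λ X Y → χp X * boundaryX X Y) n
    fourth-sem n = ≈-trans (⟦⊖⟧ (scale (binom (la ℕ.+ mb ∸ 1) la) P) n)
      (neg-cong (≈-trans (⟦scale⟧ (binom (la ℕ.+ mb ∸ 1) la) P n)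
        (≈-trans (*-cong (val-ι C₄) (≈-trans (ζsum⊛-sem α ls (liₖ (ms ++ eL ∷ ns) p) n)
             (Σ-cong (oneTo α) (λ j → *-cong (≈-refl {val (ζA j ls p)})
               (liₖ-sem (ms ++ eL ∷ ns) (p ℕ.* j) n (AllP.++⁺ posm (s≤s z≤n ∷ posn)))))))
          (≈-sym (fourth-core n)))))
      where
      P = ζsum α ls p ⊛ liₖ (ms ++ eL ∷ ns) p

    fifth-sem : ∀ n → ⟦ fifthP ⟧ n ≈ - Core (λ X Y → χp Y * boundaryY X Y) n
    fifth-sem n = ≈-trans (⟦⊖⟧ (scale (binom (la ℕ.+ mb ∸ 1) mb) P) n)
      (neg-cong (≈-trans (⟦scale⟧ (binom (la ℕ.+ mb ∸ 1) mb) P n)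
        (≈-trans (*-cong (val-ι C₅) (≈-trans (ζsum⊛-sem β ms (liₖ (ls ++ eL ∷ ns) p) n)
             (Σ-cong (oneTo β) (λ j → *-cong (≈-refl {val (ζA j ms p)})
               (liₖ-sem (ls ++ eL ∷ ns) (p ℕ.* j) n (AllP.++⁺ posl (s≤s z≤n ∷ posn)))))))
          (≈-sym (fifth-core n)))))
      where
      P = ζsum β ms p ⊛ liₖ (ls ++ eL ∷ ns) p

    coefficients-agree : ∀ n → ⟦ lhsP ⟧ n ≈ ⟦ rhsP ⟧ n
    coefficients-agree n = ≈-trans (LHS-core n) (≈-trans (Core-split n) (≈-sym (≈begin
        ⟦ rhsP ⟧ n
          ≡⟨ trans (⟦⊕⟧ (firstP ⊕ secondP ⊕ thirdP ⊕ fourthP) fifthP n)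
               (cong (_+ ⟦ fifthP ⟧ n) (trans (⟦⊕⟧ (firstP ⊕ secondP ⊕ thirdP) fourthP n)
               (cong (_+ ⟦ fourthP ⟧ n) (trans (⟦⊕⟧ (firstP ⊕ secondP) thirdP n)
               (cong (_+ ⟦ thirdP ⟧ n) (⟦⊕⟧ firstP secondP n)))))) ⟩
        ⟦ firstP ⟧ n + ⟦ secondP ⟧ n + ⟦ thirdP ⟧ n + ⟦ fourthP ⟧ n + ⟦ fifthP ⟧ n
          ≈⟨ +-cong (+-cong (+-cong (+-cong (first-sem n) (second-sem n))
                                    (≈-trans (third-sem n) (≈-sym (third-core n))))
                            (fourth-sem n))
                    (fifth-sem n) ⟩
        Core pfμ n + Core pfλ n + Core (λ X Y → χp (X ℕ.+ Y) * leading X Y) n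
         - Core (λ X Y → χp X * boundaryX X Y) n - Core (λ X Y → χp Y * boundaryY X Y) n ≈∎)))
      where open ≈-Reasoning

    good-lhs : GoodP lhsP
    good-lhs = goodP-li (ls ∷ʳ la) (ms ∷ʳ mb) ns

    good-rhs : GoodP rhsP
    good-rhs = goodP-⊕ {firstP ⊕ secondP ⊕ thirdP ⊕ fourthP} {fifthP}
      (goodP-⊕ {firstP ⊕ secondP ⊕ thirdP} {fourthP}
        (goodP-⊕ {firstP ⊕ secondP} {thirdP} (goodP-⊕ {firstP} {secondP} good-first good-second) good-third)
        (good-boundary la α ls ms))
      (good-boundary mb β ms ls)
      where
      good-first : GoodP firstP
      good-first = goodP-sumP-map _ (upTo mb) (λ τ → goodP-scale (binom (la ∸ 1 ℕ.+ τ) τ) _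
        (good-ι (+ ((la ∸ 1 ℕ.+ τ) C τ))) (goodP-li ls (ms ∷ʳ (mb ∸ τ)) ((la ℕ.+ τ) ∷ ns)))
      good-second : GoodP secondP
      good-second = goodP-sumP-map _ (upTo la) (λ τ → goodP-scale (binom (mb ∸ 1 ℕ.+ τ) τ) _
        (good-ι (+ ((mb ∸ 1 ℕ.+ τ) C τ))) (goodP-li (ls ∷ʳ (la ∸ τ)) ms ((mb ℕ.+ τ) ∷ ns)))
      good-third : GoodP thirdP
      good-third = goodP-scale (ι (sgn (sum (ms ∷ʳ mb)))) _ (good-ι (sgn (sum (ms ∷ʳ mb))))
        (goodP-⊛ (ζsum r₃ κ p) (liₖ ns p) (goodP-ζsum r₃ κ) (goodP-li [] [] ns))
      good-boundary : ∀ e r κ' μ' → GoodP (⊖ scale (binom (la ℕ.+ mb ∸ 1) e) (ζsum r κ' p ⊛ liₖ (μ' ++ eL ∷ ns) p))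
      good-boundary e r κ' μ' = goodP-⊖ _ (goodP-scale (binom (la ℕ.+ mb ∸ 1) e) _ (good-ι (+ ((la ℕ.+ mb ∸ 1) C e)))
        (goodP-⊛ (ζsum r κ' p) (liₖ (μ' ++ eL ∷ ns) p) (goodP-ζsum r κ') (goodP-li [] [] (μ' ++ eL ∷ ns))))

    agree-mod-p : ∀ n → coeff n lhsP ≡[ p ] coeff n rhsP
    agree-mod-p n = ≈⇒≡[p] (coeff n lhsP) (coeff n rhsP) (coeff-good n lhsP good-lhs) (coeff-good n rhsP good-rhs)
      (≈-trans (coeff-val n lhsP good-lhs) (≈-trans (coefficients-agree n) (≈-sym (coeff-val n rhsP good-rhs))))

open import Data.Nat using (_+_)

proposition3p7 : (ls : List ℕ) (la : ℕ) (ms : List ℕ) (mb : ℕ) (ns : List ℕ) →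
    All (0 <_) ls → 0 < la → All (0 <_) ms → 0 < mb → All (0 <_) ns →
    (λ p → li (ls ∷ʳ la) (ms ∷ʳ mb) ns p)
    ≈B
    (λ p →
      sumP (map (λ τ → scale (binom (la ∸ 1 + τ) τ)
                   (li ls (ms ∷ʳ (mb ∸ τ)) ((la + τ) ∷ ns) p)) (upTo mb))
      ⊕ sumP (map (λ τ → scale (binom (mb ∸ 1 + τ) τ)
                   (li (ls ∷ʳ (la ∸ τ)) ms ((mb + τ) ∷ ns) p)) (upTo la))
      ⊕ scale (ι (sgn (sum (ms ∷ʳ mb))))
          (ζsum (length ls + length ms + 1) (ls ++ (la + mb) ∷ reverse ms) p ⊛ liₖ ns p)
      ⊕ ⊖ scale (binom (la + mb ∸ 1) la)
          (ζsum (length ls) ls p ⊛ liₖ (ms ++ (la + mb) ∷ ns) p)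
      ⊕ ⊖ scale (binom (la + mb ∸ 1) mb)
          (ζsum (length ms) ms p ⊛ liₖ (ls ++ (la + mb) ∷ ns) p))
proposition3p7 ls (suc a) ms (suc b) ns posl (s≤s z≤n) posm (s≤s z≤n) posn =
  0 , λ p prime _ n → AtPrime.Assembly.agree-mod-p p prime ls a ms b ns posl posm posn n
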